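{- Let $H$ be a graph with no semi-edges. Then for any graph $G$, any degree-obedient mapping from $V(G)$ onto $V(H)$ can be extended to a covering projection from $G$ to $H$ (i.e., there is $f_E$ such that $(f_V,f_E)$ is a covering projection).
   Context: A graph is finite and may have three kinds of edges: ordinary edges, each incident with two distinct vertices (parallel ordinary edges allowed); loops, each incident with one vertex; and semi-edges, each incident with one vertex. The degree of a vertex $u$ is (number of semi-edges at $u$) + (number of ordinary edges at $u$) + 2(number of loops at $u$). A covering projection $f:G\to H$ is a pair of maps $f_V:V(G)\to V(H)$, $f_E:E(G)\to E(H)$ such that: every loop of $G$ at $u$ maps to a loop of $H$ at $f_V(u)$; every semi-edge of $G$ at $u$ maps to a semi-edge of $H$ at $f_V(u)$; every ordinary edge $uv$ of $G$ maps either to an ordinary edge of $H$ with end-vertices $f_V(u)\ne f_V(v)$, or, when $f_V(u)=f_V(v)$, to a loop or semi-edge of $H$ at $f_V(u)$; for every loop $e$ of $H$ at $w$, $f_E^{ -1}(e)$ is a disjoint union of loops and cycles spanning all vertices of $f_V^{ -1}(w)$; for every semi-edge $e$ of $H$ at $w$, $f_E^{ -1}(e)$ is a disjoint union of ordinary edges and semi-edges spanning all vertices of $f_V^{ -1}(w)$ (each such vertex incident with exactly one of them); for every ordinary edge $e$ of $H$ with end-vertices $w,w'$, $f_E^{ -1}(e)$ is a matching of ordinary edges spanning all vertices of $f_V^{ -1}(w)\cup f_V^{ -1}(w')$. A vertex mapping $f_V:V(G)\to V(H)$ is degree-obedient if: (1) for any distinct $u,v\in V(H)$ and any $x\in f_V^{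 -1}(u)$, the number of ordinary edges of $H$ joining $u$ and $v$ equals the number of ordinary edges of $G$ joining $x$ to a vertex of $f_V^{ -1}(v)$; (2) for every $u\in V(H)$ and $x\in f_V^{ -1}(u)$, (number of semi-edges of $H$ at $u$) + 2(number of loops of $H$ at $u$) equals (number of semi-edges of $G$ at $x$) + 2(number of loops of $G$ at $x$) + $r$, where $r$ is the number of ordinary edges of $G$ joining $x$ to a vertex of $f_V^{ -1}(u)\setminus\{x\}$; (3) for every $u\in V(H)$ and $x\in f_V^{ -1}(u)$, the number of semi-edges of $G$ at $x$ is at most the number of semi-edges of $H$ at $u$. -}

module Defs where

open import Data.Nat using (ℕ; zero; suc; _+_; _*_; _≤_)
open import Data.Fin using (Fin; _≟_)
import Data.Fin as F
open import Data.Bool using (Bool; true; false; if_then_else_; _∧_; _∨_; not)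
open import Data.Product using (Σ; _×_; ∃)
open import Data.Sum using (_⊎_)
open import Relation.Nullary using (¬_)
open import Relation.Nullary.Decidable using (⌊_⌋)
open import Relation.Binary.PropositionalEquality using (_≡_; _≢_)

data Ends (n : ℕ) : Set where
  ord  : Fin n → Fin n → Ends n
  loop : Fin n → Ends n
  semi : Fin n → Ends n

record Graph : Set where
  field
    nV nE        : ℕ
    ends         : Fin nE → Ends nV
    ord-distinct : ∀ e u v → ends e ≡ ord u v → u ≢ v
open Graph public

Vertex : Graph → Set
Vertex G = Fin (nV G)

Edge : Graph → Set
Edge G = Fin (nE G)

∑ : (n : ℕ) → (Fin n → ℕ) → ℕ
∑ zero    f = 0
∑ (suc n) f = f F.zero + ∑ n (λ i → f (F.suc i))

b2n : Bool → ℕ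
b2n true  = 1
b2n false = 0

-- contribution of an edge to the degree of a vertex x
mult : ∀ {n} → Ends n → Fin n → ℕ
mult (ord a b) x = b2n ⌊ a ≟ x ⌋ + b2n ⌊ b ≟ x ⌋
mult (loop a)  x = 2 * b2n ⌊ a ≟ x ⌋
mult (semi a)  x = b2n ⌊ a ≟ x ⌋

degIn : (G : Graph) → (Edge G → Bool) → Vertex G → ℕ
degIn G P x = ∑ (nE G) (λ e → if P e then mult (ends G e) x else 0)

isSemiAt : ∀ {n} → Ends n → Fin n → Bool
isSemiAt (semi a) x = ⌊ a ≟ x ⌋
isSemiAt _        x = false

isLoopAt : ∀ {n} → Ends n → Fin n → Bool
isLoopAt (loop a) x = ⌊ a ≟ x ⌋
isLoopAt _        x = false

isOrdJoin : ∀ {n} → Ends n → Fin n → (Fin n → Bool) → Bool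
isOrdJoin (ord a b) x S = (⌊ a ≟ x ⌋ ∧ S b) ∨ (⌊ b ≟ x ⌋ ∧ S a)
isOrdJoin _         x S = false

numSemi : (G : Graph) → Vertex G → ℕ
numSemi G x = ∑ (nE G) (λ e → b2n (isSemiAt (ends G e) x))

numLoop : (G : Graph) → Vertex G → ℕ
numLoop G x = ∑ (nE G) (λ e → b2n (isLoopAt (ends G e) x))

ordJoin : (G : Graph) → Vertex G → (Vertex G → Bool) → ℕ
ordJoin G x S = ∑ (nE G) (λ e → b2n (isOrdJoin (ends G e) x S))

NoSemiEdges : Graph → Set
NoSemiEdges H = ∀ e u → ends H e ≢ semi u

Surjective : ∀ {A : Set} {B : Set} → (A → B) → Set
Surjective {A} f = ∀ b → Σ A (λ a → f a ≡ b)

DegreeObedient : (G H : Graph) → (Vertex G → Vertex H) → Set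
DegreeObedient G H fV =
  (∀ (u v : Vertex H) → u ≢ v → ∀ (x : Vertex G) → fV x ≡ u →
     ordJoin H u (λ y → ⌊ y ≟ v ⌋) ≡ ordJoin G x (λ y → ⌊ fV y ≟ v ⌋))
  × (∀ (u : Vertex H) (x : Vertex G) → fV x ≡ u →
     numSemi H u + 2 * numLoop H u
       ≡ numSemi G x + 2 * numLoop G x
         + ordJoin G x (λ y → ⌊ fV y ≟ u ⌋ ∧ not ⌊ y ≟ x ⌋))
  × (∀ (u : Vertex H) (x : Vertex G) → fV x ≡ u → numSemi G x ≤ numSemi H u)

record IsCovering (G H : Graph) (fV : Vertex G → Vertex H) (fE : Edge G → Edge H) : Set where
  field
    loop-map : ∀ e u → ends G e ≡ loop u → ends H (fE e) ≡ loop (fV u)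
    semi-map : ∀ e u → ends G e ≡ semi u → ends H (fE e) ≡ semi (fV u)
    ord-map-distinct : ∀ e u v → ends G e ≡ ord u v → fV u ≢ fV v →
      (ends H (fE e) ≡ ord (fV u) (fV v)) ⊎ (ends H (fE e) ≡ ord (fV v) (fV u))
    ord-map-same : ∀ e u v → ends G e ≡ ord u v → fV u ≡ fV v →
      (ends H (fE e) ≡ loop (fV u)) ⊎ (ends H (fE e) ≡ semi (fV u))
    -- preimage of a loop at w: 2-regular spanning subgraph on the fibre of w
    -- (i.e. a disjoint union of loops and cycles spanning the fibre)
    loop-fibre : ∀ e w → ends H e ≡ loop w → ∀ x → fV x ≡ w →
      degIn G (λ e' → ⌊ fE e' ≟ e ⌋) x ≡ 2
    semi-fibre : ∀ e w → ends H e ≡ semi w → ∀ x → fV x ≡ w →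
      degIn G (λ e' → ⌊ fE e' ≟ e ⌋) x ≡ 1
    -- preimage of an ordinary edge ww': perfect matching of the two fibres
    ord-fibre : ∀ e w w' → ends H e ≡ ord w w' → ∀ x → (fV x ≡ w) ⊎ (fV x ≡ w') →
      degIn G (λ e' → ⌊ fE e' ≟ e ⌋) x ≡ 1

{-# OPTIONS --safe #-}
module Submission where

-- Condition (3) forbids semi-edges in G. Over a vertex of H with ℓ loops the
-- fibre spans a 2ℓ-regular multigraph (condition (2)), which, by splitting off
-- pairs of edges as in Petersen's 2-factor theorem, can be oriented with all in-
-- and out-degrees ℓ; edges between different fibres are directed from the
-- smaller fibre to the larger one. An arc (s , t) of G then joins the left port
-- (s , fV t) to the right port (t , fV s) of a bipartite multigraph in which
-- each port has exactly as many edges as there are edges of H that an arc at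
-- that port may be mapped to (by the orientation for ports inside a fibre, by
-- condition (1) for the others). A list version of König's edge-colouring
-- theorem, proved with Kempe chains, colours every edge of G by an admissible
-- edge of H so that each port sees each admissible colour exactly once. A loop
-- of H is then met twice at each vertex of its fibre, once by a leaving and once
-- by an entering arc, and an ordinary edge of H once: this is the covering
-- condition.

open import Defs
open import Data.Bool using (Bool; true; false; if_then_else_; _∧_; _∨_; not)
import Data.Bool.Properties as Boolₚ
open import Data.Empty using (⊥-elim)
open import Data.Fin as Fin using (Fin; _≟_)
import Data.Fin.Properties as Finₚ
open import Data.Fin.Permutation.Components using (transpose; transpose-inverse)
open import Data.Maybe using (Maybe; just; nothing)
import Data.Maybe.Properties as Maybeₚ
open import Data.Nat using (ℕ; zero; suc; _+_; _*_; _≤_; _<_; z≤n; s≤s)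
open import Data.Nat.Divisibility using (_∣_; divides; ∣m+n∣m⇒∣n; ∣1⇒≡1)
open import Data.Nat.Properties hiding (_≟_)
import Data.Nat.Properties as ℕₚ
open import Data.Nat.Tactic.RingSolver using (solve-∀)
open import Algebra.Properties.CommutativeSemigroup +-commutativeSemigroup using (interchange; x∙yz≈y∙xz; xy∙z≈xz∙y)
open import Data.Product using (Σ; _×_; _,_; proj₁; proj₂; swap)
import Data.Product.Properties as Productₚ
open import Data.Sum using (_⊎_; inj₁; inj₂; [_,_]′)
import Data.Sum
open import Data.Vec.Functional using (_∷_; insertAt)
open import Data.Vec.Functional.Properties using (insertAt-lookup; insertAt-punchIn)
open import Function using (_∘_)
open import Function.Bundles using (mk⇔)
open import Relation.Binary.Definitions using (DecidableEquality; tri<; tri≈; tri>)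
open import Relation.Binary.PropositionalEquality
open import Relation.Nullary using (¬_; Dec; yes; no; does)
open import Relation.Nullary.Decidable using (⌊_⌋; ⌊⌋-map′; _×-dec_; isYes≗does; dec-true; dec-false; does-⇔)

⌊⌋-true : ∀ {P : Set} (p? : Dec P) → P → ⌊ p? ⌋ ≡ true
⌊⌋-true p? p = trans (isYes≗does p?) (dec-true p? p)

⌊⌋-false : ∀ {P : Set} (p? : Dec P) → ¬ P → ⌊ p? ⌋ ≡ false
⌊⌋-false p? ¬p = trans (isYes≗does p?) (dec-false p? ¬p)

⌊⌋-true⁻¹ : ∀ {P : Set} (p? : Dec P) → ⌊ p? ⌋ ≡ true → P
⌊⌋-true⁻¹ (yes p) _ = p

⌊⌋-⇔ : ∀ {P Q : Set} (p? : Dec P) (q? : Dec Q) → (P → Q) → (Q → P) → ⌊ p? ⌋ ≡ ⌊ q? ⌋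
⌊⌋-⇔ p? q? P→Q Q→P = trans (isYes≗does p?) (trans (does-⇔ (mk⇔ P→Q Q→P) p? q?) (sym (isYes≗does q?)))

b2n-yes : ∀ {P : Set} (p? : Dec P) → P → b2n ⌊ p? ⌋ ≡ 1
b2n-yes p? p = cong b2n (⌊⌋-true p? p)

b2n-no : ∀ {P : Set} (p? : Dec P) → ¬ P → b2n ⌊ p? ⌋ ≡ 0
b2n-no p? ¬p = cong b2n (⌊⌋-false p? ¬p)

b2n-∨ : ∀ a b → (a ≡ true → b ≡ false) → b2n (a ∨ b) ≡ b2n a + b2n b
b2n-∨ true  b disjoint = cong (λ b → 1 + b2n b) (sym (disjoint refl))
b2n-∨ false b disjoint = refl

∑-cong : ∀ n {f g : Fin n → ℕ} → (∀ i → f i ≡ g i) → ∑ n f ≡ ∑ n g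
∑-cong zero    f≗g = refl
∑-cong (suc n) f≗g = cong₂ _+_ (f≗g Fin.zero) (∑-cong n (f≗g ∘ Fin.suc))

∑-zero : ∀ n → ∑ n (λ _ → 0) ≡ 0
∑-zero zero    = refl
∑-zero (suc n) = ∑-zero n

∑-distrib-+ : ∀ n (f g : Fin n → ℕ) → ∑ n (λ i → f i + g i) ≡ ∑ n f + ∑ n g
∑-distrib-+ zero    f g = refl
∑-distrib-+ (suc n) f g = trans (cong (f Fin.zero + g Fin.zero +_) (∑-distrib-+ n (f ∘ Fin.suc) (g ∘ Fin.suc)))
                                (interchange (f Fin.zero) (g Fin.zero) _ _)

∑-comm : ∀ n m (f : Fin n → Fin m → ℕ) → ∑ n (λ i → ∑ m (f i)) ≡ ∑ m (λ j → ∑ n (λ i → f i j))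
∑-comm zero    m f = sym (∑-zero m)
∑-comm (suc n) m f = trans (cong (∑ m (f Fin.zero) +_) (∑-comm n m (f ∘ Fin.suc)))
                           (sym (∑-distrib-+ m (f Fin.zero) _))

∑-remove : ∀ n (f : Fin (suc n) → ℕ) j → ∑ (suc n) f ≡ f j + ∑ n (f ∘ Fin.punchIn j)
∑-remove n       f Fin.zero    = refl
∑-remove (suc n) f (Fin.suc j) = trans (cong (f Fin.zero +_) (∑-remove n (f ∘ Fin.suc) j))
                                       (x∙yz≈y∙xz (f Fin.zero) (f (Fin.suc j)) _)

∑-mono-≤ : ∀ n {f g : Fin n → ℕ} → (∀ i → f i ≤ g i) → ∑ n f ≤ ∑ n g
∑-mono-≤ zero    f≤g = z≤n
∑-mono-≤ (suc n) f≤g = +-mono-≤ (f≤g Fin.zero) (∑-mono-≤ n (f≤g ∘ Fin.suc))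

≤-∑ : ∀ n (f : Fin n → ℕ) i → f i ≤ ∑ n f
≤-∑ (suc n) f Fin.zero    = m≤m+n _ _
≤-∑ (suc n) f (Fin.suc i) = ≤-trans (≤-∑ n (f ∘ Fin.suc) i) (m≤n+m _ _)

∑≢0⇒≢0 : ∀ n (f : Fin n → ℕ) → ¬ ∑ n f ≡ 0 → Σ (Fin n) (λ i → ¬ f i ≡ 0)
∑≢0⇒≢0 zero    f ∑≢0 = ⊥-elim (∑≢0 refl)
∑≢0⇒≢0 (suc n) f ∑≢0 with f Fin.zero ℕₚ.≟ 0
... | no  f0≢0 = Fin.zero , f0≢0
... | yes f0≡0 = let i , fi≢0 = ∑≢0⇒≢0 n (f ∘ Fin.suc) (∑≢0 ∘ trans (cong (_+ ∑ n (f ∘ Fin.suc)) f0≡0))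
                 in Fin.suc i , fi≢0

∑-mono-≤-≡ : ∀ n {f g : Fin n → ℕ} → (∀ i → f i ≤ g i) → ∑ n f ≡ ∑ n g → ∀ i → f i ≡ g i
∑-mono-≤-≡ (suc n) f≤g ∑≡ Fin.zero =
  ≤-antisym (f≤g Fin.zero)
            (+-cancelʳ-≤ _ _ _ (≤-trans (+-monoʳ-≤ _ (∑-mono-≤ n (f≤g ∘ Fin.suc))) (≤-reflexive (sym ∑≡))))
∑-mono-≤-≡ (suc n) f≤g ∑≡ (Fin.suc i) =
  ∑-mono-≤-≡ n (f≤g ∘ Fin.suc)
             (+-cancelˡ-≡ _ _ _ (trans ∑≡ (cong (_+ _) (sym (∑-mono-≤-≡ (suc n) f≤g ∑≡ Fin.zero))))) i

count : ∀ {m} → (Fin m → Bool) → ℕ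
count {m} P = ∑ m (λ i → b2n (P i))

b2n≤1 : ∀ b → b2n b ≤ 1
b2n≤1 true  = s≤s z≤n
b2n≤1 false = z≤n

count≤ : ∀ {m} (P : Fin m → Bool) → count P ≤ m
count≤ {zero}  P = z≤n
count≤ {suc m} P = +-mono-≤ (b2n≤1 (P Fin.zero)) (count≤ (P ∘ Fin.suc))

count-false : ∀ {m} (P : Fin m → Bool) → (∀ i → P i ≡ false) → count P ≡ 0
count-false {m} P P≗false = trans (∑-cong m (cong b2n ∘ P≗false)) (∑-zero m)

count≢0 : ∀ {m} (P : Fin m → Bool) → ¬ count P ≡ 0 → Σ (Fin m) (λ i → P i ≡ true)
count≢0 {m} P count≢0 with ∑≢0⇒≢0 m (b2n ∘ P) count≢0
... | i , Pi≢0 with P i in Pi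
...   | true  = i , Pi
...   | false = ⊥-elim (Pi≢0 refl)

count-split : ∀ {m} (S P : Fin m → Bool) →
              count P ≡ count (λ i → S i ∧ P i) + count (λ i → not (S i) ∧ P i)
count-split {m} S P = trans (∑-cong m split) (∑-distrib-+ m _ _)
  where
  split : ∀ i → b2n (P i) ≡ b2n (S i ∧ P i) + b2n (not (S i) ∧ P i)
  split i with S i
  ... | true  = sym (+-identityʳ _)
  ... | false = refl

count-single : ∀ {m} (g : Fin m) (P : Fin m → Bool) → count (λ i → ⌊ g ≟ i ⌋ ∧ P i) ≡ b2n (P g)
count-single {suc m} Fin.zero    P = trans (cong (b2n (P Fin.zero) +_) (count-false {m} _ (λ _ → refl))) (+-identityʳ _)
count-single {suc m} (Fin.suc g) P = trans (∑-cong m shift) (count-single g (P ∘ Fin.suc))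
  where
  shift : ∀ i → b2n (⌊ Fin.suc g ≟ Fin.suc i ⌋ ∧ P (Fin.suc i)) ≡ b2n (⌊ g ≟ i ⌋ ∧ P (Fin.suc i))
  shift i with g ≟ i
  ... | yes _ = refl
  ... | no  _ = refl

insert : ∀ {m} → Fin m → (Fin m → Bool) → Fin m → Bool
insert g S i = S i ∨ ⌊ g ≟ i ⌋

count-insert : ∀ {m} (S P : Fin m → Bool) {g} → S g ≡ false →
               count (λ i → insert g S i ∧ P i) ≡ count (λ i → S i ∧ P i) + b2n (P g)
count-insert {m} S P {g} g∉S =
  trans (∑-cong m split) (trans (∑-distrib-+ m _ _) (cong (count (λ i → S i ∧ P i) +_) (count-single g P)))
  where
  split : ∀ i → b2n (insert g S i ∧ P i) ≡ b2n (S i ∧ P i) + b2n (⌊ g ≟ i ⌋ ∧ P i)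
  split i with g ≟ i
  ... | yes refl rewrite g∉S = refl
  ... | no  _ with S i
  ...   | true  = sym (+-identityʳ _)
  ...   | false = refl

count-∧-true : ∀ {m} (S : Fin m → Bool) → count (λ i → S i ∧ true) ≡ count S
count-∧-true {m} S = ∑-cong m (cong b2n ∘ Boolₚ.∧-identityʳ ∘ S)

insert-cases : ∀ {m} {g : Fin m} S i → insert g S i ≡ true → S i ≡ true ⊎ g ≡ i
insert-cases {g = g} S i g∈ with S i
... | true  = inj₁ refl
... | false = inj₂ (⌊⌋-true⁻¹ (g ≟ i) g∈)

count-insert-size : ∀ {m} (S : Fin m → Bool) {g} → S g ≡ false → count (insert g S) ≡ suc (count S)
count-insert-size S {g} g∉S = begin
  count (insert g S)                ≡⟨ sym (count-∧-true (insert g S)) ⟩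
  count (λ i → insert g S i ∧ true) ≡⟨ count-insert S (λ _ → true) g∉S ⟩
  count (λ i → S i ∧ true) + 1      ≡⟨ cong (_+ 1) (count-∧-true S) ⟩
  count S + 1                       ≡⟨ +-comm (count S) 1 ⟩
  suc (count S)                     ∎
  where open ≡-Reasoning

count≡0 : ∀ {m} (P : Fin m → Bool) → count P ≡ 0 → ∀ i → P i ≡ false
count≡0 {m} P count≡0 i with P i | ≤-∑ m (b2n ∘ P) i
... | false | _        = refl
... | true  | 1≤count = ⊥-elim (1+n≰n (subst (1 ≤_) count≡0 1≤count))


-- Balanced orientations of even multigraphs

direct : {A : Set} → Bool → A × A → A × A
direct true  e = e
direct false e = swap e

direct-cases : ∀ {A : Set} d (e : A × A) → direct d e ≡ e ⊎ direct d e ≡ swap e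
direct-cases true  e = inj₁ refl
direct-cases false e = inj₂ refl

2∣n+n : ∀ n → 2 ∣ n + n
2∣n+n n = divides n (trans (cong (n +_) (sym (+-identityʳ n))) (*-comm 2 n))

module Orientation {V : Set} (_≟V_ : DecidableEquality V) where

  δ : V → V → ℕ
  δ u v = b2n ⌊ u ≟V v ⌋

  endsAt : V × V → V → ℕ
  endsAt (p , q) v = δ p v + δ q v

  degree outdegree indegree : ∀ {m} → (Fin m → V × V) → V → ℕ
  degree    {m} E v = ∑ m (λ i → endsAt (E i) v)
  outdegree {m} E v = ∑ m (λ i → δ (proj₁ (E i)) v)
  indegree  {m} E v = ∑ m (λ i → δ (proj₂ (E i)) v)

  Balanced : ∀ {m} → (Fin m → V × V) → Set
  Balanced E = ∀ v → outdegree E v ≡ indegree E v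

  outdegree+indegree : ∀ {m} (E : Fin m → V × V) v → outdegree E v + indegree E v ≡ degree E v
  outdegree+indegree {m} E v = sym (∑-distrib-+ m _ _)

  endsAt≢0 : ∀ e {a} → ¬ endsAt e a ≡ 0 → Σ V (λ w → e ≡ (a , w) ⊎ e ≡ (w , a))
  endsAt≢0 (p , q) {a} ≢0 with p ≟V a | q ≟V a
  ... | yes refl | _        = q , inj₁ refl
  ... | no _     | yes refl = p , inj₂ refl
  ... | no _     | no _     = ⊥-elim (≢0 refl)

  endsAt-direct : ∀ d e v → endsAt (direct d e) v ≡ endsAt e v
  endsAt-direct true  e       v = refl
  endsAt-direct false (p , q) v = +-comm (δ q v) (δ p v)

  redirect : ∀ {a w : V} e → e ≡ (a , w) ⊎ e ≡ (w , a) → ∀ d → Σ Bool (λ x → direct x e ≡ direct d (a , w))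
  redirect e (inj₁ refl) d     = d , refl
  redirect e (inj₂ refl) true  = false , refl
  redirect e (inj₂ refl) false = true , refl

  Orients : ∀ {m} → (Fin m → V × V) → (Fin m → Bool) → Set
  Orients E o = Balanced (λ i → direct (o i) (E i))

  passes-through : ∀ (π : V × V → V) → Set
  passes-through π = ∀ d a b w v →
    δ (π (direct d (a , b))) v + δ (π (direct (not d) (a , w))) v ≡ δ a v + δ (π (direct d (w , b))) v

  proj₁-passes-through : passes-through proj₁
  proj₁-passes-through true  a b w v = refl
  proj₁-passes-through false a b w v = +-comm (δ b v) (δ a v)

  proj₂-passes-through : passes-through proj₂
  proj₂-passes-through true  a b w v = +-comm (δ b v) (δ a v)
  proj₂-passes-through false a b w v = refl

  -- Splitting off: the first edge a b and the edge j at a form a path b – a – w,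
  -- which is replaced by a single edge w b; an orientation of the smaller
  -- multigraph is routed back through a.
  module SplittingOff {k} (E : Fin (suc (suc k)) → V × V) {a b w} (j : Fin (suc k))
                      (E₀ : E Fin.zero ≡ (a , b)) (Eⱼ : E (Fin.suc j) ≡ (a , w) ⊎ E (Fin.suc j) ≡ (w , a)) where

    E' : Fin (suc k) → V × V
    E' = (w , b) ∷ (E ∘ Fin.suc ∘ Fin.punchIn j)

    endsAt-Eⱼ : ∀ v → endsAt (E (Fin.suc j)) v ≡ δ a v + δ w v
    endsAt-Eⱼ v = [ cong (λ e → endsAt e v) , (λ eq → trans (cong (λ e → endsAt e v) eq) (+-comm (δ w v) (δ a v))) ]′ Eⱼ

    degree-E : ∀ v → degree E v ≡ (δ a v + δ a v) + degree E' v
    degree-E v = begin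
      endsAt (E Fin.zero) v + ∑ (suc k) (λ i → endsAt (E (Fin.suc i)) v)
        ≡⟨ cong₂ _+_ (cong (λ e → endsAt e v) E₀) (∑-remove k (λ i → endsAt (E (Fin.suc i)) v) j) ⟩
      (δ a v + δ b v) + (endsAt (E (Fin.suc j)) v + R)
        ≡⟨ cong (λ x → (δ a v + δ b v) + (x + R)) (endsAt-Eⱼ v) ⟩
      (δ a v + δ b v) + ((δ a v + δ w v) + R)
        ≡⟨ regroup (δ a v) (δ b v) (δ w v) R ⟩
      (δ a v + δ a v) + ((δ w v + δ b v) + R) ∎
      where
      open ≡-Reasoning
      regroup : ∀ a b w r → (a + b) + ((a + w) + r) ≡ (a + a) + ((w + b) + r)
      regroup = solve-∀
      R : ℕ
      R = ∑ k (λ i → endsAt (E (Fin.suc (Fin.punchIn j i))) v)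

    degree-E'-even : (∀ v → 2 ∣ degree E v) → ∀ v → 2 ∣ degree E' v
    degree-E'-even even v = ∣m+n∣m⇒∣n (subst (2 ∣_) (degree-E v) (even v)) (2∣n+n (δ a v))

    lift : (Fin (suc k) → Bool) → Fin (suc (suc k)) → Bool
    lift o' = o' Fin.zero ∷ insertAt (o' ∘ Fin.suc) j (proj₁ (redirect (E (Fin.suc j)) Eⱼ (not (o' Fin.zero))))

    module _ (o' : Fin (suc k) → Bool) where

      private
        d : Bool
        d = o' Fin.zero
        o : Fin (suc (suc k)) → Bool
        o = lift o'

      routed : ∀ (π : V × V → V) → passes-through π → ∀ v →
               ∑ (suc (suc k)) (λ i → δ (π (direct (o i) (E i))) v)
               ≡ δ a v + ∑ (suc k) (λ i → δ (π (direct (o' i) (E' i))) v)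
      routed π through v = begin
        δ (π (direct d (E Fin.zero))) v + ∑ (suc k) (λ i → δ (π (direct (o (Fin.suc i)) (E (Fin.suc i)))) v)
          ≡⟨ cong₂ _+_ (cong (λ e → δ (π (direct d e)) v) E₀)
                       (∑-remove k (λ i → δ (π (direct (o (Fin.suc i)) (E (Fin.suc i)))) v) j) ⟩
        δ (π (direct d (a , b))) v + (δ (π (direct (o (Fin.suc j)) (E (Fin.suc j)))) v + R)
          ≡⟨ cong (λ e → δ (π (direct d (a , b))) v + (δ (π e) v + R)) routedⱼ ⟩
        δ (π (direct d (a , b))) v + (δ (π (direct (not d) (a , w))) v + R)
          ≡⟨ sym (+-assoc (δ (π (direct d (a , b))) v) _ R) ⟩
        (δ (π (direct d (a , b))) v + δ (π (direct (not d) (a , w))) v) + R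
          ≡⟨ cong (_+ R) (through d a b w v) ⟩
        (δ a v + δ (π (direct d (w , b))) v) + R
          ≡⟨ +-assoc (δ a v) _ R ⟩
        δ a v + (δ (π (direct d (w , b))) v + R)
          ≡⟨ cong (λ r → δ a v + (δ (π (direct d (w , b))) v + r)) (∑-cong k rest) ⟩
        δ a v + ∑ (suc k) (λ i → δ (π (direct (o' i) (E' i))) v) ∎
        where
        open ≡-Reasoning
        x : Bool
        x = proj₁ (redirect (E (Fin.suc j)) Eⱼ (not d))
        R : ℕ
        R = ∑ k (λ i → δ (π (direct (o (Fin.suc (Fin.punchIn j i))) (E (Fin.suc (Fin.punchIn j i))))) v)
        routedⱼ : direct (o (Fin.suc j)) (E (Fin.suc j)) ≡ direct (not d) (a , w)
        routedⱼ = trans (cong (λ y → direct y (E (Fin.suc j))) (insertAt-lookup (o' ∘ Fin.suc) j x))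
                        (proj₂ (redirect (E (Fin.suc j)) Eⱼ (not d)))
        rest : ∀ i → δ (π (direct (o (Fin.suc (Fin.punchIn j i))) (E (Fin.suc (Fin.punchIn j i))))) v
                   ≡ δ (π (direct (o' (Fin.suc i)) (E' (Fin.suc i)))) v
        rest i = cong (λ y → δ (π (direct y (E' (Fin.suc i)))) v) (insertAt-punchIn (o' ∘ Fin.suc) j x i)

      lift-orients : Orients E' o' → Orients E (lift o')
      lift-orients balanced′ v = begin
        outdegree (λ i → direct (o i) (E i)) v             ≡⟨ routed proj₁ proj₁-passes-through v ⟩
        δ a v + outdegree (λ i → direct (o' i) (E' i)) v   ≡⟨ cong (δ a v +_) (balanced′ v) ⟩
        δ a v + indegree (λ i → direct (o' i) (E' i)) v    ≡⟨ sym (routed proj₂ proj₂-passes-through v) ⟩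
        indegree (λ i → direct (o i) (E i)) v              ∎
        where open ≡-Reasoning

  orient-by-splitting : ∀ {m} (E : Fin (suc m) → V × V) {a b w} (j : Fin m) →
                        E Fin.zero ≡ (a , b) → E (Fin.suc j) ≡ (a , w) ⊎ E (Fin.suc j) ≡ (w , a) →
                        (∀ v → 2 ∣ degree E v) →
                        ((E' : Fin m → V × V) → (∀ v → 2 ∣ degree E' v) → Σ (Fin m → Bool) (Orients E')) →
                        Σ (Fin (suc m) → Bool) (Orients E)
  orient-by-splitting {suc k} E j E₀ Eⱼ even orient = lift (proj₁ IH) , lift-orients (proj₁ IH) (proj₂ IH)
    where
    open SplittingOff E j E₀ Eⱼ
    IH : Σ (Fin (suc k) → Bool) (Orients E')
    IH = orient E' (degree-E'-even even)

  balanced-orientation : ∀ {m} (E : Fin m → V × V) → (∀ v → 2 ∣ degree E v) → Σ (Fin m → Bool) (Orients E)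
  balanced-orientation {zero}  E even = (λ ()) , (λ v → refl)
  balanced-orientation {suc m} E even with proj₁ (E Fin.zero) ≟V proj₂ (E Fin.zero)
  ... | yes a≡b = true ∷ proj₁ IH , λ v → cong₂ _+_ (cong (λ x → δ x v) a≡b) (proj₂ IH v)
    where
    a : V
    a = proj₁ (E Fin.zero)
    IH : Σ (Fin m → Bool) (Orients (E ∘ Fin.suc))
    IH = balanced-orientation (E ∘ Fin.suc) λ v →
           ∣m+n∣m⇒∣n (even v) (subst (λ b → 2 ∣ δ a v + δ b v) a≡b (2∣n+n (δ a v)))
  ... | no a≢b = let j , a∈Eⱼ = edge-at-a in
                 orient-by-splitting E j refl (proj₂ (endsAt≢0 (E (Fin.suc j)) a∈Eⱼ)) even balanced-orientation
    where
    a : V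
    a = proj₁ (E Fin.zero)
    degree-a : degree E a ≡ 1 + degree (E ∘ Fin.suc) a
    degree-a = cong₂ (λ x y → x + y + degree (E ∘ Fin.suc) a) (b2n-yes (a ≟V a) refl) (b2n-no (_ ≟V a) (a≢b ∘ sym))
    2≢1 : ¬ 2 ≡ 1
    2≢1 ()
    edge-at-a : Σ (Fin m) (λ i → ¬ endsAt (E (Fin.suc i)) a ≡ 0)
    edge-at-a = ∑≢0⇒≢0 m (λ i → endsAt (E (Fin.suc i)) a)
                  (λ rest≡0 → 2≢1 (∣1⇒≡1 (subst (2 ∣_) (trans degree-a (cong (1 +_) rest≡0)) (even a))))

-- List edge-colouring of bipartite multigraphs

transpose-preserves : ∀ {n} (P : Fin n → Set) {i j k : Fin n} → P i → P j → P k → P (transpose i j k)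
transpose-preserves P {i} {j} {k} Pi Pj Pk with does (k ≟ i)
... | true  = Pj
... | false with does (k ≟ j)
...   | true  = Pi
...   | false = Pk

transpose-≟ : ∀ {n} (i j a k : Fin n) → ⌊ transpose i j a ≟ k ⌋ ≡ ⌊ a ≟ transpose j i k ⌋
transpose-≟ i j a k = ⌊⌋-⇔ (transpose i j a ≟ k) (a ≟ transpose j i k)
  (λ eq → trans (sym (transpose-inverse j i)) (cong (transpose j i) eq))
  (λ eq → trans (cong (transpose i j) eq) (transpose-inverse i j))

transpose-matchˡ : ∀ {n} (i j : Fin n) → transpose i j i ≡ j
transpose-matchˡ i j rewrite dec-true (i ≟ i) refl = refl

transpose-matchʳ : ∀ {n} {i j : Fin n} → i ≢ j → transpose i j j ≡ i
transpose-matchʳ {i = i} {j} i≢j rewrite dec-false (j ≟ i) (i≢j ∘ sym) | dec-true (j ≟ j) refl = refl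

transpose-other : ∀ {n} {i j k : Fin n} → k ≢ i → k ≢ j → transpose i j k ≡ k
transpose-other {i = i} {j} {k} k≢i k≢j rewrite dec-false (k ≟ i) k≢i | dec-false (k ≟ j) k≢j = refl

swap-bound : ∀ {iα iβ oα oβ} → iα + oα ≤ 1 → iβ + oβ ≤ 1 → iα ≡ iβ ⊎ (oα ≡ 0 × oβ ≡ 0) →
             iβ + oα ≤ 1 × iα + oβ ≤ 1
swap-bound α≤1 β≤1 (inj₁ refl)          = α≤1 , β≤1
swap-bound α≤1 β≤1 (inj₂ (refl , refl)) = ≤-trans (+-monoʳ-≤ _ z≤n) β≤1 , ≤-trans (+-monoʳ-≤ _ z≤n) α≤1

excess-saturates : ∀ {i j o} → i ≡ suc j → i + o ≤ 1 → o ≡ 0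
excess-saturates refl (s≤s j+o≤0) = m+n≡0⇒n≡0 _ (n≤0⇒n≡0 j+o≤0)

swapOn : ∀ {m c} → (Fin m → Bool) → Fin c → Fin c → (Fin m → Fin c) → Fin m → Fin c
swapOn S α β col e = if S e then transpose α β (col e) else col e

-- One side of a bipartite multigraph: end e is the endpoint of edge e on this side.
module Side {V : Set} (_≟V_ : DecidableEquality V) {c m : ℕ} (end : Fin m → V) where

  incident : (Fin m → Fin c) → V → Fin c → Fin m → Bool
  incident col v k e = ⌊ col e ≟ k ⌋ ∧ ⌊ end e ≟V v ⌋

  at : (Fin m → Fin c) → V → Fin c → ℕ
  at col v k = count (incident col v k)

  degree : V → ℕ
  degree v = count (λ e → ⌊ end e ≟V v ⌋)

  ∑-at : ∀ col v → ∑ c (at col v) ≡ degree v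
  ∑-at col v = trans (∑-comm c m λ k e → b2n (incident col v k e))
                     (∑-cong m λ e → count-single (col e) (λ _ → ⌊ end e ≟V v ⌋))

  Respects : (V → Fin c → Bool) → (Fin m → Fin c) → Set
  Respects P col = ∀ e → P (end e) (col e) ≡ true

  missing-colour : ∀ (P : V → Fin c → Bool) col v → degree v < count (P v) →
                   Σ (Fin c) (λ k → P v k ≡ true × at col v k ≡ 0)
  missing-colour P col v deg<size with Finₚ.any? (λ k → (P v k Boolₚ.≟ true) ×-dec (at col v k ℕₚ.≟ 0))
  ... | yes found = found
  ... | no  none  = ⊥-elim (<⇒≱ deg<size (≤-trans (∑-mono-≤ c used) (≤-reflexive (∑-at col v))))
    where
    used : ∀ k → b2n (P v k) ≤ at col v k
    used k with P v k in Pvk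
    ... | false = z≤n
    ... | true  = n≢0⇒n>0 (λ at≡0 → none (k , Pvk , at≡0))

  at≤palette : ∀ (P : V → Fin c → Bool) col → Respects P col → ∀ v k → at col v k ≤ 1 → at col v k ≤ b2n (P v k)
  at≤palette P col respects v k at≤1 with P v k in Pvk
  ... | true  = at≤1
  ... | false = ≤-reflexive (count-false _ not-incident)
    where
    not-incident : ∀ e → incident col v k e ≡ false
    not-incident e with col e ≟ k | end e ≟V v
    ... | yes refl | yes refl = ⊥-elim (Boolₚ.not-¬ Pvk (respects e))
    ... | yes _    | no _     = refl
    ... | no _     | _        = refl

  at≡1 : ∀ (P : V → Fin c → Bool) col → Respects P col → ∀ v → (∀ k → at col v k ≤ 1) →
         degree v ≡ count (P v) → ∀ k → P v k ≡ true → at col v k ≡ 1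
  at≡1 P col respects v at≤1 deg≡size k Pvk =
    trans (∑-mono-≤-≡ c (λ k → at≤palette P col respects v k (at≤1 k)) (trans (∑-at col v) deg≡size) k) (cong b2n Pvk)

  inside outside : (Fin m → Bool) → (Fin m → Fin c) → V → Fin c → ℕ
  inside  S col v k = count (λ e → S e ∧ incident col v k e)
  outside S col v k = count (λ e → not (S e) ∧ incident col v k e)

  at-split : ∀ S col v k → at col v k ≡ inside S col v k + outside S col v k
  at-split S col v k = count-split S (incident col v k)

  inside≤at : ∀ S col v k → inside S col v k ≤ at col v k
  inside≤at S col v k = ≤-trans (m≤m+n _ _) (≤-reflexive (sym (at-split S col v k)))

  outside≤at : ∀ S col v k → outside S col v k ≤ at col v k
  outside≤at S col v k = ≤-trans (m≤n+m _ _) (≤-reflexive (sym (at-split S col v k)))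

  inside-insert-same : ∀ S col {g γ w} → S g ≡ false → col g ≡ γ → end g ≡ w → ∀ v →
                       inside (insert g S) col v γ ≡ inside S col v γ + b2n ⌊ w ≟V v ⌋
  inside-insert-same S col {g} g∉S refl refl v =
    trans (count-insert S (incident col v (col g)) g∉S)
          (cong (λ b → inside S col v (col g) + b2n (b ∧ ⌊ end g ≟V v ⌋)) (⌊⌋-true (col g ≟ col g) refl))

  inside-insert-other : ∀ S col {g κ} → S g ≡ false → col g ≢ κ → ∀ v →
                        inside (insert g S) col v κ ≡ inside S col v κ
  inside-insert-other S col {g} {κ} g∉S col-g≢κ v =
    trans (count-insert S (incident col v κ) g∉S)
          (trans (cong (λ b → inside S col v κ + b2n (b ∧ ⌊ end g ≟V v ⌋)) (⌊⌋-false (col g ≟ κ) col-g≢κ))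
                 (+-identityʳ _))

  outside-edge : ∀ S col v k → ¬ outside S col v k ≡ 0 → Σ (Fin m) (λ g → S g ≡ false × col g ≡ k × end g ≡ v)
  outside-edge S col v k outside≢0 =
    let g , g∈ = count≢0 _ outside≢0
        incident-g = Boolₚ.∧-conicalʳ (not (S g)) _ g∈
    in g , Boolₚ.not-injective (Boolₚ.∧-conicalˡ _ _ g∈)
         , ⌊⌋-true⁻¹ (col g ≟ k) (Boolₚ.∧-conicalˡ _ _ incident-g)
         , ⌊⌋-true⁻¹ (end g ≟V v) (Boolₚ.∧-conicalʳ _ _ incident-g)

  at-swapOn : ∀ S α β col v k → at (swapOn S α β col) v k ≡ inside S col v (transpose β α k) + outside S col v k
  at-swapOn S α β col v k = trans (∑-cong m split) (∑-distrib-+ m _ _)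
    where
    split : ∀ e → b2n (incident (swapOn S α β col) v k e)
                ≡ b2n (S e ∧ incident col v (transpose β α k) e) + b2n (not (S e) ∧ incident col v k e)
    split e with S e
    ... | true  = trans (cong (λ b → b2n (b ∧ ⌊ end e ≟V v ⌋)) (transpose-≟ α β (col e) k)) (sym (+-identityʳ _))
    ... | false = refl

  Swappable : (Fin m → Bool) → (Fin m → Fin c) → V → Fin c → Fin c → Set
  Swappable S col v α β = inside S col v α ≡ inside S col v β ⊎ (outside S col v α ≡ 0 × outside S col v β ≡ 0)

  swappable-bounds : ∀ S col v {α β} → (∀ k → at col v k ≤ 1) → Swappable S col v α β →
                     inside S col v β + outside S col v α ≤ 1 × inside S col v α + outside S col v β ≤ 1
  swappable-bounds S col v {α} {β} at≤1 =
    swap-bound (subst (_≤ 1) (at-split S col v α) (at≤1 α)) (subst (_≤ 1) (at-split S col v β) (at≤1 β))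

  swapOn-at≤1 : ∀ S col v {α β} → α ≢ β → (∀ k → at col v k ≤ 1) → Swappable S col v α β →
                ∀ k → at (swapOn S α β col) v k ≤ 1
  swapOn-at≤1 S col v {α} {β} α≢β at≤1 swappable k =
    subst (_≤ 1) (sym (at-swapOn S α β col v k)) (bound k (k ≟ α) (k ≟ β))
    where
    bounds : inside S col v β + outside S col v α ≤ 1 × inside S col v α + outside S col v β ≤ 1
    bounds = swappable-bounds S col v at≤1 swappable
    bound : ∀ k → Dec (k ≡ α) → Dec (k ≡ β) → inside S col v (transpose β α k) + outside S col v k ≤ 1
    bound k (yes refl) _ =
      subst (λ t → inside S col v t + outside S col v k ≤ 1) (sym (transpose-matchʳ (α≢β ∘ sym))) (proj₁ bounds)
    bound k (no _) (yes refl) =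
      subst (λ t → inside S col v t + outside S col v k ≤ 1) (sym (transpose-matchˡ β α)) (proj₂ bounds)
    bound k (no k≢α) (no k≢β) =
      subst (λ t → inside S col v t + outside S col v k ≤ 1) (sym (transpose-other k≢β k≢α))
            (subst (_≤ 1) (at-split S col v k) (at≤1 k))

at-∷≤1 : ∀ {V : Set} (_≟V_ : DecidableEquality V) {c m} (end : Fin (suc m) → V) {col : Fin m → Fin c} {α} →
         Side.at _≟V_ (end ∘ Fin.suc) col (end Fin.zero) α ≡ 0 → (∀ v k → Side.at _≟V_ (end ∘ Fin.suc) col v k ≤ 1) →
         ∀ v k → Side.at _≟V_ end (α ∷ col) v k ≤ 1
at-∷≤1 _≟V_ end {α = α} α-free at≤1 v k with α ≟ k | end Fin.zero ≟V v
... | yes refl | yes refl = s≤s (≤-reflexive α-free)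
... | yes _    | no _     = at≤1 v k
... | no _     | _        = at≤1 v k


module ListColouring {L R : Set} (_≟L_ : DecidableEquality L) (_≟R_ : DecidableEquality R)
                     {c : ℕ} (A : L → Fin c → Bool) (B : R → Fin c → Bool) where

  module SL = Side _≟L_ {c}
  module SR = Side _≟R_ {c}

  record Proper {m} (l : Fin m → L) (r : Fin m → R) (col : Fin m → Fin c) : Set where
    field
      allowed : SL.Respects l A col
      atL≤1   : ∀ x k → SL.at l col x k ≤ 1
      atR≤1   : ∀ y k → SR.at r col y k ≤ 1

  module Kempe {m} (l : Fin m → L) (r : Fin m → R) (compat : ∀ e k → A (l e) k ≡ B (r e) k)
               {col : Fin m → Fin c} (proper : Proper l r col) {x₀ : L} {y₀ : R} {α β : Fin c} (α≢β : α ≢ β)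
               (α∈B : B y₀ α ≡ true) (β∈B : B y₀ β ≡ true)
               (x₀-misses-α : SL.at l col x₀ α ≡ 0) (y₀-misses-β : SR.at r col y₀ β ≡ 0) where

    open Proper proper

    insideL outsideL : (Fin m → Bool) → L → Fin c → ℕ
    insideL  S = SL.inside l S col
    outsideL S = SL.outside l S col

    insideR outsideR : (Fin m → Bool) → R → Fin c → ℕ
    insideR  S = SR.inside r S col
    outsideR S = SR.outside r S col

    isEndL : L ⊎ R → L → ℕ
    isEndL (inj₁ v) x = b2n ⌊ v ≟L x ⌋
    isEndL (inj₂ _) x = 0

    isEndR : L ⊎ R → R → ℕ
    isEndR (inj₁ _) y = 0
    isEndR (inj₂ w) y = b2n ⌊ w ≟R y ⌋

    palette : L ⊎ R → Fin c → Bool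
    palette (inj₁ x) = A x
    palette (inj₂ y) = B y

    -- S is the part of the α/β Kempe chain of y₀ found so far: a path from y₀
    -- to end, starting with an α-edge. The balance equations say that every
    -- other vertex meets S in as many α-edges as β-edges.
    record Chain (end : L ⊎ R) : Set where
      field
        S           : Fin m → Bool
        palette-S   : ∀ e → S e ≡ true → ∀ k → A (l e) k ≡ B y₀ k
        palette-end : ∀ k → palette end k ≡ B y₀ k
        balanceL    : ∀ x → insideL S x α ≡ isEndL end x + insideL S x β
        balanceR    : ∀ y → insideR S y β + b2n ⌊ y₀ ≟R y ⌋ ≡ isEndR end y + insideR S y α

    start : Chain (inj₂ y₀)
    start = record
      { S           = λ _ → false
      ; palette-S   = λ _ ()
      ; palette-end = λ _ → refl
      ; balanceL    = λ _ → refl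
      ; balanceR    = λ y → +-comm (insideR (λ _ → false) y β) (b2n ⌊ y₀ ≟R y ⌋)
      }

    extend-at-L : ∀ {v} (ch : Chain (inj₁ v)) {g} → Chain.S ch g ≡ false → col g ≡ β → l g ≡ v → Chain (inj₂ (r g))
    extend-at-L {v} ch {g} g∉S col-g lg = record
      { S           = insert g S
      ; palette-S   = λ e e∈ → [ palette-S e , (λ { refl → palette-g }) ]′ (insert-cases S e e∈)
      ; palette-end = λ k → trans (sym (compat g k)) (palette-g k)
      ; balanceL    = balL
      ; balanceR    = balR
      }
      where
      open Chain ch
      open ≡-Reasoning
      palette-g : ∀ k → A (l g) k ≡ B y₀ k
      palette-g k = trans (cong (λ x → A x k) lg) (palette-end k)
      col-g≢α : col g ≢ α
      col-g≢α col-g≡α = α≢β (trans (sym col-g≡α) col-g)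
      balL : ∀ x → insideL (insert g S) x α ≡ 0 + insideL (insert g S) x β
      balL x = begin
        insideL (insert g S) x α        ≡⟨ SL.inside-insert-other l S col g∉S col-g≢α x ⟩
        insideL S x α                   ≡⟨ balanceL x ⟩
        b2n ⌊ v ≟L x ⌋ + insideL S x β  ≡⟨ +-comm (b2n ⌊ v ≟L x ⌋) _ ⟩
        insideL S x β + b2n ⌊ v ≟L x ⌋  ≡⟨ sym (SL.inside-insert-same l S col g∉S col-g lg x) ⟩
        insideL (insert g S) x β        ∎
      balR : ∀ y → insideR (insert g S) y β + b2n ⌊ y₀ ≟R y ⌋ ≡ b2n ⌊ r g ≟R y ⌋ + insideR (insert g S) y α
      balR y = begin
        insideR (insert g S) y β + s  ≡⟨ cong (_+ s) (SR.inside-insert-same r S col g∉S col-g refl y) ⟩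
        (insideR S y β + t) + s       ≡⟨ xy∙z≈xz∙y (insideR S y β) t s ⟩
        (insideR S y β + s) + t       ≡⟨ cong (_+ t) (balanceR y) ⟩
        insideR S y α + t             ≡⟨ +-comm (insideR S y α) t ⟩
        t + insideR S y α             ≡⟨ cong (t +_) (sym (SR.inside-insert-other r S col g∉S col-g≢α y)) ⟩
        t + insideR (insert g S) y α  ∎
        where
        s = b2n ⌊ y₀ ≟R y ⌋
        t = b2n ⌊ r g ≟R y ⌋

    extend-at-R : ∀ {w} (ch : Chain (inj₂ w)) {g} → Chain.S ch g ≡ false → col g ≡ α → r g ≡ w → Chain (inj₁ (l g))
    extend-at-R {w} ch {g} g∉S col-g rg = record
      { S           = insert g S
      ; palette-S   = λ e e∈ → [ palette-S e , (λ { refl → palette-g }) ]′ (insert-cases S e e∈)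
      ; palette-end = palette-g
      ; balanceL    = balL
      ; balanceR    = balR
      }
      where
      open Chain ch
      open ≡-Reasoning
      palette-g : ∀ k → A (l g) k ≡ B y₀ k
      palette-g k = trans (compat g k) (trans (cong (λ y → B y k) rg) (palette-end k))
      col-g≢β : col g ≢ β
      col-g≢β col-g≡β = α≢β (trans (sym col-g) col-g≡β)
      balL : ∀ x → insideL (insert g S) x α ≡ b2n ⌊ l g ≟L x ⌋ + insideL (insert g S) x β
      balL x = begin
        insideL (insert g S) x α  ≡⟨ SL.inside-insert-same l S col g∉S col-g refl x ⟩
        insideL S x α + t         ≡⟨ cong (_+ t) (balanceL x) ⟩
        insideL S x β + t         ≡⟨ +-comm (insideL S x β) t ⟩
        t + insideL S x β         ≡⟨ cong (t +_) (sym (SL.inside-insert-other l S col g∉S col-g≢β x)) ⟩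
        t + insideL (insert g S) x β ∎
        where
        t = b2n ⌊ l g ≟L x ⌋
      balR : ∀ y → insideR (insert g S) y β + b2n ⌊ y₀ ≟R y ⌋ ≡ 0 + insideR (insert g S) y α
      balR y = begin
        insideR (insert g S) y β + s  ≡⟨ cong (_+ s) (SR.inside-insert-other r S col g∉S col-g≢β y) ⟩
        insideR S y β + s             ≡⟨ balanceR y ⟩
        t + insideR S y α             ≡⟨ +-comm t _ ⟩
        insideR S y α + t             ≡⟨ sym (SR.inside-insert-same r S col g∉S col-g rg y) ⟩
        insideR (insert g S) y α      ∎
        where
        s = b2n ⌊ y₀ ≟R y ⌋
        t = b2n ⌊ w ≟R y ⌋

    Closed : L ⊎ R → (Fin m → Bool) → Set
    Closed (inj₁ x) S = outsideL S x β ≡ 0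
    Closed (inj₂ y) S = outsideR S y α ≡ 0

    Extension : ∀ {end} → Chain end → Set
    Extension ch = Σ (L ⊎ R) (λ end' → Σ (Chain end') (λ ch' → count (Chain.S ch') ≡ suc (count (Chain.S ch))))

    closed-or-extends : ∀ end (ch : Chain end) → Closed end (Chain.S ch) ⊎ Extension ch
    closed-or-extends (inj₁ v) ch with outsideL (Chain.S ch) v β ℕₚ.≟ 0
    ... | yes closed   = inj₁ closed
    ... | no  unclosed = let g , g∉S , colg , lg = SL.outside-edge l (Chain.S ch) col v β unclosed
                       in inj₂ (inj₂ (r g) , extend-at-L ch g∉S colg lg , count-insert-size (Chain.S ch) g∉S)
    closed-or-extends (inj₂ w) ch with outsideR (Chain.S ch) w α ℕₚ.≟ 0
    ... | yes closed   = inj₁ closed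
    ... | no  unclosed = let g , g∉S , colg , rg = SR.outside-edge r (Chain.S ch) col w α unclosed
                       in inj₂ (inj₁ (l g) , extend-at-R ch g∉S colg rg , count-insert-size (Chain.S ch) g∉S)

    isEndL-view : ∀ end x → isEndL end x ≡ 0 ⊎ end ≡ inj₁ x
    isEndL-view (inj₁ v) x with v ≟L x
    ... | yes refl = inj₂ refl
    ... | no  _    = inj₁ refl
    isEndL-view (inj₂ _) x = inj₁ refl

    isEndR-view : ∀ end y → isEndR end y ≡ 0 ⊎ end ≡ inj₂ y
    isEndR-view (inj₁ _) y = inj₁ refl
    isEndR-view (inj₂ w) y with w ≟R y
    ... | yes refl = inj₂ refl
    ... | no  _    = inj₁ refl

    boundL : ∀ S x k → insideL S x k + outsideL S x k ≤ 1
    boundL S x k = subst (_≤ 1) (SL.at-split l S col x k) (atL≤1 x k)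

    boundR : ∀ S y k → insideR S y k + outsideR S y k ≤ 1
    boundR S y k = subst (_≤ 1) (SR.at-split r S col y k) (atR≤1 y k)

    y₀-excess : ∀ {end} (ch : Chain end) → isEndR end y₀ ≡ 0 →
                insideR (Chain.S ch) y₀ α ≡ suc (insideR (Chain.S ch) y₀ β)
    y₀-excess ch not-end = begin
      insideR S y₀ α                        ≡⟨ cong (_+ insideR S y₀ α) (sym not-end) ⟩
      _ + insideR S y₀ α                    ≡⟨ sym (Chain.balanceR ch y₀) ⟩
      insideR S y₀ β + b2n ⌊ y₀ ≟R y₀ ⌋     ≡⟨ cong (insideR S y₀ β +_) (b2n-yes (y₀ ≟R y₀) refl) ⟩
      insideR S y₀ β + 1                    ≡⟨ +-comm _ 1 ⟩
      suc (insideR S y₀ β)                  ∎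
      where
      open ≡-Reasoning
      S = Chain.S ch

    swappableL : ∀ {end} (ch : Chain end) → Closed end (Chain.S ch) → ∀ x → SL.Swappable l (Chain.S ch) col x α β
    swappableL {end} ch closed x with isEndL-view end x
    ... | inj₁ not-end = inj₁ (trans (Chain.balanceL ch x) (cong (_+ _) not-end))
    ... | inj₂ refl    = inj₂ (excess-saturates α-excess (boundL (Chain.S ch) x α) , closed)
      where
      α-excess : insideL (Chain.S ch) x α ≡ suc (insideL (Chain.S ch) x β)
      α-excess = trans (Chain.balanceL ch x) (cong (_+ insideL (Chain.S ch) x β) (b2n-yes (x ≟L x) refl))

    swappableR : ∀ {end} (ch : Chain end) → Closed end (Chain.S ch) → ∀ y → SR.Swappable r (Chain.S ch) col y α β
    swappableR {end} ch closed y with isEndR-view end y | y₀ ≟R y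
    ... | inj₁ not-end | yes refl = inj₂ (excess-saturates (y₀-excess ch not-end) (boundR (Chain.S ch) y₀ α)
                                         , n≤0⇒n≡0 (≤-trans (SR.outside≤at r (Chain.S ch) col y₀ β)
                                                             (≤-reflexive y₀-misses-β)))
    ... | inj₁ not-end | no y₀≢y  = inj₁ (sym (begin
      insideR S y β                     ≡⟨ sym (+-identityʳ _) ⟩
      insideR S y β + 0                 ≡⟨ cong (insideR S y β +_) (sym (b2n-no (y₀ ≟R y) y₀≢y)) ⟩
      insideR S y β + b2n ⌊ y₀ ≟R y ⌋   ≡⟨ Chain.balanceR ch y ⟩
      isEndR end y + insideR S y α      ≡⟨ cong (_+ insideR S y α) not-end ⟩
      insideR S y α                     ∎))
      where
      open ≡-Reasoning
      S = Chain.S ch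
    ... | inj₂ refl    | yes refl =
      inj₁ (sym (+-cancelʳ-≡ _ _ _ (trans (Chain.balanceR ch y₀) (+-comm _ (insideR (Chain.S ch) y₀ α)))))
    ... | inj₂ refl    | no y₀≢y  = inj₂ (closed , excess-saturates β-excess (boundR (Chain.S ch) y β))
      where
      β-excess : insideR (Chain.S ch) y β ≡ suc (insideR (Chain.S ch) y α)
      β-excess = trans (sym (+-identityʳ _)) (trans (cong (_ +_) (sym (b2n-no (y₀ ≟R y) y₀≢y)))
                   (trans (Chain.balanceR ch y) (cong (_+ insideR (Chain.S ch) y α) (b2n-yes (y ≟R y) refl))))

    swapped-allowed : ∀ {end} (ch : Chain end) → SL.Respects l A (swapOn (Chain.S ch) α β col)
    swapped-allowed ch e with Chain.S ch e in e∈S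
    ... | true  = transpose-preserves (λ k → A (l e) k ≡ true) (trans (Chain.palette-S ch e e∈S α) α∈B)
                                      (trans (Chain.palette-S ch e e∈S β) β∈B) (allowed e)
    ... | false = allowed e

    x₀-free : ∀ {end} (ch : Chain end) → SL.at l (swapOn (Chain.S ch) α β col) x₀ α ≡ 0
    x₀-free ch = begin
      SL.at l (swapOn S α β col) x₀ α                      ≡⟨ SL.at-swapOn l S α β col x₀ α ⟩
      insideL S x₀ (transpose β α α) + outsideL S x₀ α
        ≡⟨ cong₂ _+_ (cong (insideL S x₀) (transpose-matchʳ (α≢β ∘ sym))) none-outside ⟩
      insideL S x₀ β + 0                                    ≡⟨ +-identityʳ _ ⟩
      insideL S x₀ β                                        ≡⟨ m+n≡0⇒n≡0 _ (trans (sym (Chain.balanceL ch x₀)) none-inside) ⟩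
      0                                                     ∎
      where
      open ≡-Reasoning
      S = Chain.S ch
      none-inside : insideL S x₀ α ≡ 0
      none-inside = n≤0⇒n≡0 (≤-trans (SL.inside≤at l S col x₀ α) (≤-reflexive x₀-misses-α))
      none-outside : outsideL S x₀ α ≡ 0
      none-outside = n≤0⇒n≡0 (≤-trans (SL.outside≤at l S col x₀ α) (≤-reflexive x₀-misses-α))

    y₀-free : ∀ {end} (ch : Chain end) → Closed end (Chain.S ch) → SR.at r (swapOn (Chain.S ch) α β col) y₀ α ≡ 0
    y₀-free {end} ch closed = begin
      SR.at r (swapOn S α β col) y₀ α                      ≡⟨ SR.at-swapOn r S α β col y₀ α ⟩
      insideR S y₀ (transpose β α α) + outsideR S y₀ α
        ≡⟨ cong₂ _+_ (cong (insideR S y₀) (transpose-matchʳ (α≢β ∘ sym))) (outside-α (isEndR-view end y₀)) ⟩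
      insideR S y₀ β + 0                                    ≡⟨ +-identityʳ _ ⟩
      insideR S y₀ β                                        ≡⟨ n≤0⇒n≡0 (≤-trans (SR.inside≤at r S col y₀ β) (≤-reflexive y₀-misses-β)) ⟩
      0                                                     ∎
      where
      open ≡-Reasoning
      S = Chain.S ch
      outside-α : isEndR end y₀ ≡ 0 ⊎ end ≡ inj₂ y₀ → outsideR S y₀ α ≡ 0
      outside-α (inj₁ not-end) = excess-saturates (y₀-excess ch not-end) (boundR S y₀ α)
      outside-α (inj₂ refl)    = closed

    Result : Set
    Result = Σ (Fin m → Fin c) (λ col' → Proper l r col' × SL.at l col' x₀ α ≡ 0 × SR.at r col' y₀ α ≡ 0)

    swap-chain : ∀ {end} (ch : Chain end) → Closed end (Chain.S ch) → Result
    swap-chain ch closed = swapOn (Chain.S ch) α β col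
                         , record { allowed = swapped-allowed ch
                                  ; atL≤1   = λ x → SL.swapOn-at≤1 l (Chain.S ch) col x α≢β (atL≤1 x)
                                                                   (swappableL ch closed x)
                                  ; atR≤1   = λ y → SR.swapOn-at≤1 r (Chain.S ch) col y α≢β (atR≤1 y)
                                                                   (swappableR ch closed y) }
                         , x₀-free ch , y₀-free ch closed

    grow : ∀ fuel {end} (ch : Chain end) → m ≤ count (Chain.S ch) + fuel → Result
    grow fuel       {end} ch bound with closed-or-extends end ch
    grow fuel       ch bound | inj₁ closed            = swap-chain ch closed
    grow zero       ch bound | inj₂ (_ , ch' , grown) =
      ⊥-elim (<⇒≱ (subst (_≤ m) grown (count≤ (Chain.S ch'))) (subst (m ≤_) (+-identityʳ _) bound))
    grow (suc fuel) ch bound | inj₂ (_ , ch' , grown) =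
      grow fuel ch' (subst (m ≤_) (trans (+-suc _ fuel) (cong (_+ fuel) (sym grown))) bound)

    result : Result
    result = grow m start (m≤n+m m _)

  kempe-recolouring : ∀ {m} (l : Fin m → L) (r : Fin m → R) → (∀ e k → A (l e) k ≡ B (r e) k) →
                      ∀ {col} → Proper l r col → ∀ {x₀ y₀ α β} → B y₀ α ≡ true → B y₀ β ≡ true →
                      SL.at l col x₀ α ≡ 0 → SR.at r col y₀ β ≡ 0 →
                      Σ (Fin m → Fin c) (λ col' → Proper l r col' × SL.at l col' x₀ α ≡ 0 × SR.at r col' y₀ α ≡ 0)
  kempe-recolouring l r compat {col} proper {α = α} {β} α∈B β∈B x₀-misses-α y₀-misses-β with α ≟ β
  ... | yes refl = col , proper , x₀-misses-α , y₀-misses-β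
  ... | no  α≢β  = Kempe.result l r compat proper α≢β α∈B β∈B x₀-misses-α y₀-misses-β

  proper-colouring : ∀ {m} (l : Fin m → L) (r : Fin m → R) → (∀ e k → A (l e) k ≡ B (r e) k) →
                     (∀ x → SL.degree l x ≤ count (A x)) → (∀ y → SR.degree r y ≤ count (B y)) →
                     Σ (Fin m → Fin c) (Proper l r)
  proper-colouring {zero}  l r compat _ _ =
    (λ ()) , record { allowed = λ () ; atL≤1 = λ _ _ → z≤n ; atR≤1 = λ _ _ → z≤n }
  proper-colouring {suc m} l r compat degL≤ degR≤ = α ∷ proj₁ recoloured , record
    { allowed = λ { Fin.zero → α∈A ; (Fin.suc e) → Proper.allowed proper e }
    ; atL≤1   = at-∷≤1 _≟L_ l x₀-free (Proper.atL≤1 proper)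
    ; atR≤1   = at-∷≤1 _≟R_ r y₀-free (Proper.atR≤1 proper)
    }
    where
    x₀ : L
    x₀ = l Fin.zero
    y₀ : R
    y₀ = r Fin.zero
    IH : Σ (Fin m → Fin c) (Proper (l ∘ Fin.suc) (r ∘ Fin.suc))
    IH = proper-colouring (l ∘ Fin.suc) (r ∘ Fin.suc) (compat ∘ Fin.suc)
           (λ x → ≤-trans (m≤n+m _ _) (degL≤ x)) (λ y → ≤-trans (m≤n+m _ _) (degR≤ y))
    missing-α : Σ (Fin c) (λ k → A x₀ k ≡ true × SL.at (l ∘ Fin.suc) (proj₁ IH) x₀ k ≡ 0)
    missing-α = SL.missing-colour (l ∘ Fin.suc) A (proj₁ IH) x₀
                  (subst (λ t → t + SL.degree (l ∘ Fin.suc) x₀ ≤ count (A x₀)) (b2n-yes (x₀ ≟L x₀) refl) (degL≤ x₀))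
    missing-β : Σ (Fin c) (λ k → B y₀ k ≡ true × SR.at (r ∘ Fin.suc) (proj₁ IH) y₀ k ≡ 0)
    missing-β = SR.missing-colour (r ∘ Fin.suc) B (proj₁ IH) y₀
                  (subst (λ t → t + SR.degree (r ∘ Fin.suc) y₀ ≤ count (B y₀)) (b2n-yes (y₀ ≟R y₀) refl) (degR≤ y₀))
    α : Fin c
    α = proj₁ missing-α
    α∈A : A x₀ α ≡ true
    α∈A = proj₁ (proj₂ missing-α)
    recoloured : Σ (Fin m → Fin c) (λ col → Proper (l ∘ Fin.suc) (r ∘ Fin.suc) col
                                          × SL.at (l ∘ Fin.suc) col x₀ α ≡ 0 × SR.at (r ∘ Fin.suc) col y₀ α ≡ 0)
    recoloured = kempe-recolouring (l ∘ Fin.suc) (r ∘ Fin.suc) (compat ∘ Fin.suc) (proj₂ IH)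
                   (trans (sym (compat Fin.zero α)) α∈A) (proj₁ (proj₂ missing-β))
                   (proj₂ (proj₂ missing-α)) (proj₂ (proj₂ missing-β))
    proper : Proper (l ∘ Fin.suc) (r ∘ Fin.suc) (proj₁ recoloured)
    proper = proj₁ (proj₂ recoloured)
    x₀-free : SL.at (l ∘ Fin.suc) (proj₁ recoloured) x₀ α ≡ 0
    x₀-free = proj₁ (proj₂ (proj₂ recoloured))
    y₀-free : SR.at (r ∘ Fin.suc) (proj₁ recoloured) y₀ α ≡ 0
    y₀-free = proj₂ (proj₂ (proj₂ recoloured))

  exact-colouring : ∀ {m} (l : Fin m → L) (r : Fin m → R) → (∀ e k → A (l e) k ≡ B (r e) k) →
                    (∀ x → SL.degree l x ≡ count (A x)) → (∀ y → SR.degree r y ≡ count (B y)) →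
                    Σ (Fin m → Fin c) (λ col → SL.Respects l A col
                                             × (∀ x k → A x k ≡ true → SL.at l col x k ≡ 1)
                                             × (∀ y k → B y k ≡ true → SR.at r col y k ≡ 1))
  exact-colouring {m} l r compat degL≡ degR≡ =
    col , allowed , (λ x → SL.at≡1 l A col allowed x (atL≤1 x) (degL≡ x))
                  , (λ y → SR.at≡1 r B col allowedR y (atR≤1 y) (degR≡ y))
    where
    colouring : Σ (Fin m → Fin c) (Proper l r)
    colouring = proper-colouring l r compat (≤-reflexive ∘ degL≡) (≤-reflexive ∘ degR≡)
    col : Fin m → Fin c
    col = proj₁ colouring
    open Proper (proj₂ colouring)
    allowedR : SR.Respects r B col
    allowedR e = trans (sym (compat e (col e))) (allowed e)


-- The covering projection

-- fits E u v: the edge E may be the image of an arc from the fibre of u to the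
-- fibre of v. Arcs between distinct fibres always run from the smaller fibre to
-- the larger one.
fits : ∀ {n} → Ends n → Fin n → Fin n → Bool
fits E u v = if ⌊ u ≟ v ⌋ then isLoopAt E u else ⌊ u Finₚ.<? v ⌋ ∧ isOrdJoin E u (λ y → ⌊ y ≟ v ⌋)

sorted : ∀ {n} → Ends n → Fin n × Fin n
sorted (ord a b) = if ⌊ a Finₚ.<? b ⌋ then (a , b) else (b , a)
sorted (loop a)  = a , a
sorted (semi a)  = a , a

module _ {n : ℕ} where

  fits-refl : ∀ (E : Ends n) u → fits E u u ≡ isLoopAt E u
  fits-refl E u rewrite ⌊⌋-true (u ≟ u) refl = refl

  fits-< : ∀ (E : Ends n) {u v} → u Fin.< v → fits E u v ≡ isOrdJoin E u (λ y → ⌊ y ≟ v ⌋)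
  fits-< E {u} {v} u<v rewrite ⌊⌋-false (u ≟ v) (Finₚ.<⇒≢ u<v) | ⌊⌋-true (u Finₚ.<? v) u<v = refl

  fits-> : ∀ (E : Ends n) {u v} → v Fin.< u → fits E u v ≡ false
  fits-> E {u} {v} v<u
    rewrite ⌊⌋-false (u ≟ v) (Finₚ.<⇒≢ v<u ∘ sym) | ⌊⌋-false (u Finₚ.<? v) (Finₚ.<-asym v<u) = refl

  isOrdJoin-sym : ∀ (E : Ends n) u v → isOrdJoin E u (λ y → ⌊ y ≟ v ⌋) ≡ isOrdJoin E v (λ y → ⌊ y ≟ u ⌋)
  isOrdJoin-sym (ord a b) u v = trans (Boolₚ.∨-comm (⌊ a ≟ u ⌋ ∧ ⌊ b ≟ v ⌋) _)
                                      (cong₂ _∨_ (Boolₚ.∧-comm ⌊ b ≟ u ⌋ ⌊ a ≟ v ⌋) (Boolₚ.∧-comm ⌊ a ≟ u ⌋ ⌊ b ≟ v ⌋))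
  isOrdJoin-sym (loop a)  u v = refl
  isOrdJoin-sym (semi a)  u v = refl

  isLoopAt-true : ∀ (E : Ends n) {u} → isLoopAt E u ≡ true → E ≡ loop u
  isLoopAt-true (loop a) {u} a≡u = cong loop (⌊⌋-true⁻¹ (a ≟ u) a≡u)

  isOrdJoin-true : ∀ (E : Ends n) {u v} → isOrdJoin E u (λ y → ⌊ y ≟ v ⌋) ≡ true →
                   E ≡ ord u v ⊎ E ≡ ord v u
  isOrdJoin-true (ord a b) {u} {v} joins with ⌊ a ≟ u ⌋ ∧ ⌊ b ≟ v ⌋ in forward
  ... | true  = inj₁ (cong₂ ord (⌊⌋-true⁻¹ (a ≟ u) (Boolₚ.∧-conicalˡ _ _ forward))
                                (⌊⌋-true⁻¹ (b ≟ v) (Boolₚ.∧-conicalʳ _ _ forward)))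
  ... | false = inj₂ (cong₂ ord (⌊⌋-true⁻¹ (a ≟ v) (Boolₚ.∧-conicalʳ _ _ joins))
                                (⌊⌋-true⁻¹ (b ≟ u) (Boolₚ.∧-conicalˡ _ _ joins)))

  fits-cases : ∀ (E : Ends n) {u v} → fits E u v ≡ true →
               (u ≡ v × E ≡ loop u) ⊎ (u Fin.< v × (E ≡ ord u v ⊎ E ≡ ord v u))
  fits-cases E {u} {v} fits-uv with u ≟ v
  ... | yes refl = inj₁ (refl , isLoopAt-true E fits-uv)
  ... | no _ with u Finₚ.<? v
  ...   | yes u<v = inj₂ (u<v , isOrdJoin-true E fits-uv)

  fits-sorted : ∀ (E : Ends n) {u v} → fits E u v ≡ true → (u , v) ≡ sorted E
  fits-sorted E {u} {v} fits-uv with fits-cases E {u} {v} fits-uv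
  ... | inj₁ (refl , refl) = refl
  ... | inj₂ (u<v , inj₁ refl) rewrite ⌊⌋-true (u Finₚ.<? v) u<v = refl
  ... | inj₂ (u<v , inj₂ refl) rewrite ⌊⌋-false (v Finₚ.<? u) (Finₚ.<-asym u<v) = refl

  fits-refl-true : ∀ (E : Ends n) {u} → fits E u u ≡ true → E ≡ loop u
  fits-refl-true E {u} fits-uu = isLoopAt-true E (trans (sym (fits-refl E u)) fits-uu)

  fits-≢-true : ∀ (E : Ends n) {u v} → fits E u v ≡ true → u ≢ v → E ≡ ord u v ⊎ E ≡ ord v u
  fits-≢-true E fits-uv u≢v with fits-cases E fits-uv
  ... | inj₁ (u≡v , _)   = ⊥-elim (u≢v u≡v)
  ... | inj₂ (_ , joins) = joins

  fits-loop : ∀ (E : Ends n) {u} → E ≡ loop u → fits E u u ≡ true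
  fits-loop E {u} refl = trans (fits-refl E u) (⌊⌋-true (u ≟ u) refl)

  fits-ord : ∀ (E : Ends n) {u v} → u Fin.< v → E ≡ ord u v ⊎ E ≡ ord v u → fits E u v ≡ true
  fits-ord E {u} {v} u<v joins = trans (fits-< E u<v) (joined joins)
    where
    joined : E ≡ ord u v ⊎ E ≡ ord v u → isOrdJoin E u (λ y → ⌊ y ≟ v ⌋) ≡ true
    joined (inj₁ refl) rewrite ⌊⌋-true (u ≟ u) refl | ⌊⌋-true (v ≟ v) refl = refl
    joined (inj₂ refl) rewrite ⌊⌋-true (u ≟ u) refl | ⌊⌋-true (v ≟ v) refl = Boolₚ.∨-zeroʳ _

  fits-target : ∀ (E : Ends n) {u v v'} → fits E u v ≡ true → fits E u v' ≡ true → v ≡ v'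
  fits-target E fits-uv fits-uv' = cong proj₂ (trans (fits-sorted E fits-uv) (sym (fits-sorted E fits-uv')))

  fits-source : ∀ (E : Ends n) {u u' v} → fits E u v ≡ true → fits E u' v ≡ true → u ≡ u'
  fits-source E fits-uv fits-u'v = cong proj₁ (trans (fits-sorted E fits-uv) (sym (fits-sorted E fits-u'v)))

  fits-chain : ∀ (E : Ends n) {u v w} → fits E u v ≡ true → fits E v w ≡ true → u ≡ v × v ≡ w
  fits-chain E fits-uv fits-vw = let eq = trans (fits-sorted E fits-uv) (sym (fits-sorted E fits-vw))
                                 in cong proj₁ eq , cong proj₂ eq


module Construction (G H : Graph) (noSemiH : NoSemiEdges H) (fV : Vertex G → Vertex H)
                    (degree-obedient : DegreeObedient G H fV) where

  VG VH Port : Set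
  VG   = Vertex G
  VH   = Vertex H
  Port = VG × VH

  _≟ᴾ_ : DecidableEquality Port
  _≟ᴾ_ = Productₚ.≡-dec _≟_ _≟_

  _≟ᴹ_ : DecidableEquality (Maybe VG)
  _≟ᴹ_ = Maybeₚ.≡-dec _≟_

  port-≟ : ∀ a u x v → ⌊ (a , u) ≟ᴾ (x , v) ⌋ ≡ ⌊ a ≟ x ⌋ ∧ ⌊ u ≟ v ⌋
  port-≟ a u x v = by-components (a ≟ x) (u ≟ v)
    where
    by-components : (a≟x : Dec (a ≡ x)) (u≟v : Dec (u ≡ v)) → ⌊ (a , u) ≟ᴾ (x , v) ⌋ ≡ ⌊ a≟x ⌋ ∧ ⌊ u≟v ⌋
    by-components (yes refl) (yes refl) = ⌊⌋-true ((a , u) ≟ᴾ (a , u)) refl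
    by-components (yes _)    (no u≢v)   = ⌊⌋-false ((a , u) ≟ᴾ (x , v)) (u≢v ∘ cong proj₂)
    by-components (no a≢x)   _          = ⌊⌋-false ((a , u) ≟ᴾ (x , v)) (a≢x ∘ cong proj₁)

  numSemiH≡0 : ∀ u → numSemi H u ≡ 0
  numSemiH≡0 u = count-false _ semi-free
    where
    semi-free : ∀ k → isSemiAt (ends H k) u ≡ false
    semi-free k with ends H k in eqₖ
    ... | ord _ _ = refl
    ... | loop _  = refl
    ... | semi a  = ⊥-elim (noSemiH k a eqₖ)

  numSemiG≡0 : ∀ x → numSemi G x ≡ 0
  numSemiG≡0 x = n≤0⇒n≡0 (subst (numSemi G x ≤_) (numSemiH≡0 (fV x)) (proj₂ (proj₂ degree-obedient) (fV x) x refl))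

  noSemiG : NoSemiEdges G
  noSemiG e x eq = Boolₚ.not-¬ (count≡0 _ (numSemiG≡0 x) e) (trans (cong (λ E → isSemiAt E x) eq) (⌊⌋-true (x ≟ x) refl))

  module OG = Orientation {VG} _≟_
  module OM = Orientation {Maybe VG} _≟ᴹ_
  open OG using (δ; endsAt)

  δᴾ : Port → Port → ℕ
  δᴾ p q = b2n ⌊ p ≟ᴾ q ⌋

  δ-just : ∀ a x → OM.δ (just a) (just x) ≡ δ a x
  δ-just a x = cong b2n (⌊⌋-map′ (cong just) Maybeₚ.just-injective (a ≟ x))

  same-fibre-port : ∀ {s t} → fV s ≡ fV t → ∀ x → δᴾ (s , fV t) (x , fV x) ≡ δ s x
  same-fibre-port {s} {t} fs≡ft x rewrite port-≟ s (fV t) x (fV x) with s ≟ x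
  ... | yes refl = cong b2n (⌊⌋-true (fV t ≟ fV s) (sym fs≡ft))
  ... | no  _    = refl

  other-fibre-port : ∀ {s t} → fV s ≢ fV t → ∀ x → δᴾ (s , fV t) (x , fV x) ≡ 0
  other-fibre-port {s} {t} fs≢ft x rewrite port-≟ s (fV t) x (fV x) with s ≟ x
  ... | yes refl = cong b2n (⌊⌋-false (fV t ≟ fV s) (fs≢ft ∘ sym))
  ... | no  _    = refl

  direction : Bool → VG → VG → Bool
  direction b p q = if ⌊ fV p ≟ fV q ⌋ then b else ⌊ fV p Finₚ.<? fV q ⌋

  arc : Bool → Ends (nV G) → VG × VG
  arc b (ord p q) = direct (direction b p q) (p , q)
  arc b (loop a)  = a , a
  arc b (semi a)  = a , a

  leftPort rightPort : VG × VG → Port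
  leftPort  (s , t) = s , fV t
  rightPort (s , t) = t , fV s

  -- Edges between different fibres are parked as loops at nothing, which keeps
  -- all degrees even.
  intra : Ends (nV G) → Maybe VG × Maybe VG
  intra (ord p q) = if ⌊ fV p ≟ fV q ⌋ then (just p , just q) else (nothing , nothing)
  intra (loop a)  = just a , just a
  intra (semi a)  = nothing , nothing

  NotSemi : Ends (nV G) → Set
  NotSemi E = ∀ a → E ≢ semi a

  OrdDistinct : Ends (nV G) → Set
  OrdDistinct E = ∀ p q → E ≡ ord p q → p ≢ q

  mult-arc : ∀ b E → NotSemi E → ∀ x → mult E x ≡ endsAt (arc b E) x
  mult-arc b (ord p q) _ x = sym (OG.endsAt-direct (direction b p q) (p , q) x)
  mult-arc b (loop a)  _ x = cong (δ a x +_) (+-identityʳ (δ a x))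
  mult-arc b (semi a)  ns  = ⊥-elim (ns a refl)

  arc-monotone : ∀ b E → fV (proj₁ (arc b E)) Fin.≤ fV (proj₂ (arc b E))
  arc-monotone b (ord p q) with fV p ≟ fV q
  arc-monotone true  (ord p q) | yes fp≡fq = Finₚ.≤-reflexive fp≡fq
  arc-monotone false (ord p q) | yes fp≡fq = Finₚ.≤-reflexive (sym fp≡fq)
  arc-monotone b     (ord p q) | no _ with fV p Finₚ.<? fV q
  ... | yes fp<fq = <⇒≤ fp<fq
  ... | no  fp≮fq = ≮⇒≥ fp≮fq
  arc-monotone b (loop a) = Finₚ.≤-refl
  arc-monotone b (semi a) = Finₚ.≤-refl

  portsAt : VG × VG → Port → ℕ
  portsAt e p = δᴾ (leftPort e) p + δᴾ (rightPort e) p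

  portsAt-direct : ∀ d e p → portsAt (direct d e) p ≡ portsAt e p
  portsAt-direct true  e       p = refl
  portsAt-direct false (s , t) p = +-comm (δᴾ (t , fV s) p) _

  ports-join : ∀ b E → NotSemi E → OrdDistinct E → ∀ x v → fV x ≢ v →
               b2n (isOrdJoin E x (λ y → ⌊ fV y ≟ v ⌋)) ≡ portsAt (arc b E) (x , v)
  ports-join b (ord p q) _ distinct x v _ = begin
    b2n ((⌊ p ≟ x ⌋ ∧ ⌊ fV q ≟ v ⌋) ∨ (⌊ q ≟ x ⌋ ∧ ⌊ fV p ≟ v ⌋))
      ≡⟨ b2n-∨ _ _ disjoint ⟩
    b2n (⌊ p ≟ x ⌋ ∧ ⌊ fV q ≟ v ⌋) + b2n (⌊ q ≟ x ⌋ ∧ ⌊ fV p ≟ v ⌋)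
      ≡⟨ sym (cong₂ _+_ (cong b2n (port-≟ p (fV q) x v)) (cong b2n (port-≟ q (fV p) x v))) ⟩
    portsAt (p , q) (x , v)
      ≡⟨ sym (portsAt-direct (direction b p q) (p , q) (x , v)) ⟩
    portsAt (arc b (ord p q)) (x , v) ∎
    where
    open ≡-Reasoning
    disjoint : ⌊ p ≟ x ⌋ ∧ ⌊ fV q ≟ v ⌋ ≡ true → ⌊ q ≟ x ⌋ ∧ ⌊ fV p ≟ v ⌋ ≡ false
    disjoint p-end with ⌊⌋-true⁻¹ (p ≟ x) (Boolₚ.∧-conicalˡ _ _ p-end)
    ... | refl = cong (_∧ ⌊ fV p ≟ v ⌋) (⌊⌋-false (q ≟ p) (distinct p q refl ∘ sym))
  ports-join b (loop a)  _ _ x v fx≢v = sym (cong₂ _+_ own-fibre own-fibre)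
    where
    own-fibre : δᴾ (a , fV a) (x , v) ≡ 0
    own-fibre rewrite port-≟ a (fV a) x v with a ≟ x
    ... | yes refl = cong b2n (⌊⌋-false (fV a ≟ v) fx≢v)
    ... | no  _    = refl
  ports-join b (semi a)  ns _ = ⊥-elim (ns a refl)

  δ-nothing : ∀ b x → OM.δ (proj₁ (direct b (nothing , nothing))) (just x) ≡ 0
                    × OM.δ (proj₂ (direct b (nothing , nothing))) (just x) ≡ 0
  δ-nothing true  x = refl , refl
  δ-nothing false x = refl , refl

  direct-fibres : ∀ d {p q} → fV p ≢ fV q → fV (proj₁ (direct d (p , q))) ≢ fV (proj₂ (direct d (p , q)))
  direct-fibres true  fp≢fq = fp≢fq
  direct-fibres false fp≢fq = fp≢fq ∘ sym

  left-intra : ∀ b E → NotSemi E → ∀ x →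
               δᴾ (leftPort (arc b E)) (x , fV x) ≡ OM.δ (proj₁ (direct b (intra E))) (just x)
  left-intra b (ord p q) _ x with fV p ≟ fV q
  left-intra true  (ord p q) _ x | yes fp≡fq = trans (same-fibre-port fp≡fq x) (sym (δ-just p x))
  left-intra false (ord p q) _ x | yes fp≡fq = trans (same-fibre-port (sym fp≡fq) x) (sym (δ-just q x))
  left-intra b     (ord p q) _ x | no  fp≢fq =
    trans (other-fibre-port (direct-fibres ⌊ fV p Finₚ.<? fV q ⌋ fp≢fq) x) (sym (proj₁ (δ-nothing b x)))
  left-intra true  (loop a) _ x = trans (same-fibre-port refl x) (sym (δ-just a x))
  left-intra false (loop a) _ x = trans (same-fibre-port refl x) (sym (δ-just a x))
  left-intra b     (semi a) ns  = ⊥-elim (ns a refl)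

  right-intra : ∀ b E → NotSemi E → ∀ x →
                δᴾ (rightPort (arc b E)) (x , fV x) ≡ OM.δ (proj₂ (direct b (intra E))) (just x)
  right-intra b (ord p q) _ x with fV p ≟ fV q
  right-intra true  (ord p q) _ x | yes fp≡fq = trans (same-fibre-port (sym fp≡fq) x) (sym (δ-just q x))
  right-intra false (ord p q) _ x | yes fp≡fq = trans (same-fibre-port fp≡fq x) (sym (δ-just p x))
  right-intra b     (ord p q) _ x | no  fp≢fq =
    trans (other-fibre-port (direct-fibres ⌊ fV p Finₚ.<? fV q ⌋ fp≢fq ∘ sym) x) (sym (proj₂ (δ-nothing b x)))
  right-intra true  (loop a) _ x = trans (same-fibre-port refl x) (sym (δ-just a x))
  right-intra false (loop a) _ x = trans (same-fibre-port refl x) (sym (δ-just a x))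
  right-intra b     (semi a) ns  = ⊥-elim (ns a refl)

  intra-nothing : ∀ E → OM.endsAt (intra E) nothing ≡ OM.δ (proj₁ (intra E)) nothing + OM.δ (proj₁ (intra E)) nothing
  intra-nothing (ord p q) with fV p ≟ fV q
  ... | yes _ = refl
  ... | no  _ = refl
  intra-nothing (loop a) = refl
  intra-nothing (semi a) = refl

  NeighbourInFibre : Ends (nV G) → VG → Bool
  NeighbourInFibre E x = isOrdJoin E x (λ y → ⌊ fV y ≟ fV x ⌋ ∧ not ⌊ y ≟ x ⌋)

  intra-just : ∀ E → OrdDistinct E → ∀ x →
               OM.endsAt (intra E) (just x) ≡ (b2n (isLoopAt E x) + b2n (isLoopAt E x)) + b2n (NeighbourInFibre E x)
  intra-just (ord p q) distinct x with fV p ≟ fV q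
  ... | yes fp≡fq = trans (cong₂ _+_ (δ-just p x) (δ-just q x)) (same-fibre (p ≟ x) (q ≟ x))
    where
    same-fibre : (p≟x : Dec (p ≡ x)) (q≟x : Dec (q ≡ x)) → b2n ⌊ p≟x ⌋ + b2n ⌊ q≟x ⌋
                 ≡ b2n ((⌊ p≟x ⌋ ∧ (⌊ fV q ≟ fV x ⌋ ∧ not ⌊ q≟x ⌋)) ∨ (⌊ q≟x ⌋ ∧ (⌊ fV p ≟ fV x ⌋ ∧ not ⌊ p≟x ⌋)))
    same-fibre (yes refl) (yes q≡p) = ⊥-elim (distinct p q refl (sym q≡p))
    same-fibre (yes refl) (no _)    rewrite ⌊⌋-true (fV q ≟ fV p) (sym fp≡fq) = refl
    same-fibre (no _)     (yes refl) rewrite ⌊⌋-true (fV p ≟ fV q) fp≡fq = refl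
    same-fibre (no _)     (no _)    = refl
  ... | no fp≢fq = sym (other-fibre (p ≟ x) (q ≟ x))
    where
    other-fibre : (p≟x : Dec (p ≡ x)) (q≟x : Dec (q ≡ x)) →
                  b2n ((⌊ p≟x ⌋ ∧ (⌊ fV q ≟ fV x ⌋ ∧ not ⌊ q≟x ⌋)) ∨ (⌊ q≟x ⌋ ∧ (⌊ fV p ≟ fV x ⌋ ∧ not ⌊ p≟x ⌋))) ≡ 0
    other-fibre (yes refl) (yes q≡p) = ⊥-elim (fp≢fq (cong fV (sym q≡p)))
    other-fibre (yes refl) (no _)    rewrite ⌊⌋-false (fV q ≟ fV p) (fp≢fq ∘ sym) = refl
    other-fibre (no _)     (yes refl) rewrite ⌊⌋-false (fV p ≟ fV q) fp≢fq = refl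
    other-fibre (no _)     (no _)    = refl
  intra-just (loop a) _ x = trans (cong₂ _+_ (δ-just a x) (δ-just a x)) (sym (+-identityʳ _))
  intra-just (semi a) _ x = refl

  loops-balance : ∀ x → numLoop H (fV x) + numLoop H (fV x)
                        ≡ (numLoop G x + numLoop G x) + ∑ (nE G) (λ e → b2n (NeighbourInFibre (ends G e) x))
  loops-balance x = begin
    ℓH + ℓH                                ≡⟨ cong (ℓH +_) (sym (+-identityʳ ℓH)) ⟩
    2 * ℓH                                 ≡⟨ cong (_+ 2 * ℓH) (sym (numSemiH≡0 (fV x))) ⟩
    numSemi H (fV x) + 2 * ℓH              ≡⟨ proj₁ (proj₂ degree-obedient) (fV x) x refl ⟩
    numSemi G x + 2 * ℓG + r               ≡⟨ cong (λ s → s + 2 * ℓG + r) (numSemiG≡0 x) ⟩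
    (ℓG + (ℓG + 0)) + r                    ≡⟨ cong (λ t → (ℓG + t) + r) (+-identityʳ ℓG) ⟩
    (ℓG + ℓG) + r                          ∎
    where
    open ≡-Reasoning
    ℓH = numLoop H (fV x)
    ℓG = numLoop G x
    r = ∑ (nE G) (λ e → b2n (NeighbourInFibre (ends G e) x))

  intra-graph : Fin (nE G) → Maybe VG × Maybe VG
  intra-graph e = intra (ends G e)

  intra-degree : ∀ x → OM.degree intra-graph (just x) ≡ numLoop H (fV x) + numLoop H (fV x)
  intra-degree x = begin
    OM.degree intra-graph (just x)
      ≡⟨ ∑-cong (nE G) (λ e → intra-just (ends G e) (ord-distinct G e) x) ⟩
    ∑ (nE G) (λ e → (ℓ e + ℓ e) + b2n (NeighbourInFibre (ends G e) x))
      ≡⟨ ∑-distrib-+ (nE G) (λ e → ℓ e + ℓ e) _ ⟩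
    ∑ (nE G) (λ e → ℓ e + ℓ e) + r
      ≡⟨ cong (_+ r) (∑-distrib-+ (nE G) ℓ ℓ) ⟩
    (numLoop G x + numLoop G x) + r
      ≡⟨ sym (loops-balance x) ⟩
    numLoop H (fV x) + numLoop H (fV x) ∎
    where
    open ≡-Reasoning
    ℓ : Fin (nE G) → ℕ
    ℓ e = b2n (isLoopAt (ends G e) x)
    r = ∑ (nE G) (λ e → b2n (NeighbourInFibre (ends G e) x))

  intra-even : ∀ v → 2 ∣ OM.degree intra-graph v
  intra-even nothing  =
    subst (2 ∣_) (sym (trans (∑-cong (nE G) (intra-nothing ∘ ends G)) (∑-distrib-+ (nE G) n n))) (2∣n+n (∑ (nE G) n))
    where
    n : Fin (nE G) → ℕ
    n e = OM.δ (proj₁ (intra-graph e)) nothing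
  intra-even (just x) = subst (2 ∣_) (sym (intra-degree x)) (2∣n+n (numLoop H (fV x)))

  orientation : Σ (Fin (nE G) → Bool) (OM.Orients intra-graph)
  orientation = OM.balanced-orientation intra-graph intra-even

  arcᴳ : Fin (nE G) → VG × VG
  arcᴳ e = arc (proj₁ orientation e) (ends G e)

  lp rp : Fin (nE G) → Port
  lp = leftPort ∘ arcᴳ
  rp = rightPort ∘ arcᴳ

  module PS = Side _≟ᴾ_ {nE H}

  double-injective : ∀ {m n} → m + m ≡ n + n → m ≡ n
  double-injective {m} {n} eq = *-cancelˡ-≡ m n 2
    (trans (cong (m +_) (+-identityʳ m)) (trans eq (sym (cong (n +_) (+-identityʳ n)))))

  own-fibre-degrees : ∀ x → PS.degree lp (x , fV x) ≡ numLoop H (fV x) × PS.degree rp (x , fV x) ≡ numLoop H (fV x)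
  own-fibre-degrees x = out≡ℓ , trans in≡out out≡ℓ
    where
    directed : Fin (nE G) → Maybe VG × Maybe VG
    directed e = direct (proj₁ orientation e) (intra-graph e)
    out≡ : PS.degree lp (x , fV x) ≡ OM.outdegree directed (just x)
    out≡ = ∑-cong (nE G) (λ e → left-intra (proj₁ orientation e) (ends G e) (noSemiG e) x)
    in≡ : PS.degree rp (x , fV x) ≡ OM.indegree directed (just x)
    in≡ = ∑-cong (nE G) (λ e → right-intra (proj₁ orientation e) (ends G e) (noSemiG e) x)
    in≡out : PS.degree rp (x , fV x) ≡ PS.degree lp (x , fV x)
    in≡out = trans in≡ (trans (sym (proj₂ orientation (just x))) (sym out≡))
    total : PS.degree lp (x , fV x) + PS.degree rp (x , fV x) ≡ numLoop H (fV x) + numLoop H (fV x)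
    total = begin
      PS.degree lp (x , fV x) + PS.degree rp (x , fV x)    ≡⟨ cong₂ _+_ out≡ in≡ ⟩
      OM.outdegree directed (just x) + OM.indegree directed (just x) ≡⟨ OM.outdegree+indegree directed (just x) ⟩
      OM.degree directed (just x)
        ≡⟨ ∑-cong (nE G) (λ e → OM.endsAt-direct (proj₁ orientation e) (intra-graph e) (just x)) ⟩
      OM.degree intra-graph (just x)                        ≡⟨ intra-degree x ⟩
      numLoop H (fV x) + numLoop H (fV x)                   ∎
      where open ≡-Reasoning
    out≡ℓ : PS.degree lp (x , fV x) ≡ numLoop H (fV x)
    out≡ℓ = double-injective (trans (cong (PS.degree lp (x , fV x) +_) (sym in≡out)) total)

  other-fibre-degrees : ∀ x v → fV x ≢ v →
                        PS.degree lp (x , v) + PS.degree rp (x , v) ≡ ordJoin G x (λ y → ⌊ fV y ≟ v ⌋)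
  other-fibre-degrees x v fx≢v = trans (sym (∑-distrib-+ (nE G) _ _))
    (∑-cong (nE G) (λ e → sym (ports-join (proj₁ orientation e) (ends G e) (noSemiG e) (ord-distinct G e) x v fx≢v)))

  left-vanishes : ∀ {x v} → v Fin.< fV x → PS.degree lp (x , v) ≡ 0
  left-vanishes {x} {v} v<fx = count-false _ λ e → ⌊⌋-false (lp e ≟ᴾ (x , v)) λ { refl →
    <⇒≱ v<fx (arc-monotone (proj₁ orientation e) (ends G e)) }

  right-vanishes : ∀ {x v} → fV x Fin.< v → PS.degree rp (x , v) ≡ 0
  right-vanishes {x} {v} fx<v = count-false _ λ e → ⌊⌋-false (rp e ≟ᴾ (x , v)) λ { refl →
    <⇒≱ fx<v (arc-monotone (proj₁ orientation e) (ends G e)) }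

  palette-left palette-right : Port → Fin (nE H) → Bool
  palette-left  (x , v) k = fits (ends H k) (fV x) v
  palette-right (y , u) k = fits (ends H k) u (fV y)

  left-degree : ∀ p → PS.degree lp p ≡ count (palette-left p)
  left-degree (x , v) with Finₚ.<-cmp (fV x) v
  ... | tri< fx<v _ _ = begin
    PS.degree lp (x , v)                          ≡⟨ sym (+-identityʳ _) ⟩
    PS.degree lp (x , v) + 0                      ≡⟨ cong (PS.degree lp (x , v) +_) (sym (right-vanishes fx<v)) ⟩
    PS.degree lp (x , v) + PS.degree rp (x , v)   ≡⟨ other-fibre-degrees x v (Finₚ.<⇒≢ fx<v) ⟩
    ordJoin G x (λ y → ⌊ fV y ≟ v ⌋)              ≡⟨ sym (proj₁ degree-obedient (fV x) v (Finₚ.<⇒≢ fx<v) x refl) ⟩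
    ordJoin H (fV x) (λ y → ⌊ y ≟ v ⌋)            ≡⟨ sym (∑-cong (nE H) (λ k → cong b2n (fits-< (ends H k) fx<v))) ⟩
    count (palette-left (x , v))                  ∎
    where open ≡-Reasoning
  ... | tri≈ _ refl _ = trans (proj₁ (own-fibre-degrees x)) (sym (∑-cong (nE H) (λ k → cong b2n (fits-refl (ends H k) (fV x)))))
  ... | tri> _ _ v<fx = trans (left-vanishes v<fx) (sym (count-false _ (λ k → fits-> (ends H k) v<fx)))

  right-degree : ∀ p → PS.degree rp p ≡ count (palette-right p)
  right-degree (y , u) with Finₚ.<-cmp u (fV y)
  ... | tri< u<fy _ _ = begin
    PS.degree rp (y , u)                          ≡⟨ cong (_+ PS.degree rp (y , u)) (sym (left-vanishes u<fy)) ⟩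
    PS.degree lp (y , u) + PS.degree rp (y , u)   ≡⟨ other-fibre-degrees y u (Finₚ.<⇒≢ u<fy ∘ sym) ⟩
    ordJoin G y (λ z → ⌊ fV z ≟ u ⌋)              ≡⟨ sym (proj₁ degree-obedient (fV y) u (Finₚ.<⇒≢ u<fy ∘ sym) y refl) ⟩
    ordJoin H (fV y) (λ z → ⌊ z ≟ u ⌋)            ≡⟨ ∑-cong (nE H) (λ k → cong b2n (isOrdJoin-sym (ends H k) (fV y) u)) ⟩
    ordJoin H u (λ z → ⌊ z ≟ fV y ⌋)              ≡⟨ sym (∑-cong (nE H) (λ k → cong b2n (fits-< (ends H k) u<fy))) ⟩
    count (palette-right (y , u))                 ∎
    where open ≡-Reasoning
  ... | tri≈ _ refl _ = trans (proj₂ (own-fibre-degrees y)) (sym (∑-cong (nE H) (λ k → cong b2n (fits-refl (ends H k) (fV y)))))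
  ... | tri> _ _ fy<u = trans (right-vanishes fy<u) (sym (count-false _ (λ k → fits-> (ends H k) fy<u)))

  open ListColouring _≟ᴾ_ _≟ᴾ_ palette-left palette-right using (exact-colouring)

  colouring : Σ (Edge G → Edge H) (λ col → PS.Respects lp palette-left col
                                           × (∀ p k → palette-left p k ≡ true → PS.at lp col p k ≡ 1)
                                           × (∀ p k → palette-right p k ≡ true → PS.at rp col p k ≡ 1))
  colouring = exact-colouring lp rp (λ e k → refl) left-degree right-degree

  fE : Edge G → Edge H
  fE = proj₁ colouring

  image-fits : ∀ e → fits (ends H (fE e)) (fV (proj₁ (arcᴳ e))) (fV (proj₂ (arcᴳ e))) ≡ true
  image-fits = proj₁ (proj₂ colouring)

  tails heads : VG → Fin (nE H) → ℕ
  tails x k = count (λ e → ⌊ fE e ≟ k ⌋ ∧ ⌊ proj₁ (arcᴳ e) ≟ x ⌋)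
  heads x k = count (λ e → ⌊ fE e ≟ k ⌋ ∧ ⌊ proj₂ (arcᴳ e) ≟ x ⌋)

  preimage-degree : ∀ k x → degIn G (λ e → ⌊ fE e ≟ k ⌋) x ≡ tails x k + heads x k
  preimage-degree k x = trans (∑-cong (nE G) split) (∑-distrib-+ (nE G) _ _)
    where
    split : ∀ e → (if ⌊ fE e ≟ k ⌋ then mult (ends G e) x else 0)
                ≡ b2n (⌊ fE e ≟ k ⌋ ∧ ⌊ proj₁ (arcᴳ e) ≟ x ⌋)
                  + b2n (⌊ fE e ≟ k ⌋ ∧ ⌊ proj₂ (arcᴳ e) ≟ x ⌋)
    split e with ⌊ fE e ≟ k ⌋
    ... | true  = mult-arc (proj₁ orientation e) (ends G e) (noSemiG e) x
    ... | false = refl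

  tails-port : ∀ {k x v} → fits (ends H k) (fV x) v ≡ true → tails x k ≡ PS.at lp fE (x , v) k
  tails-port {k} {x} {v} fits-xv = ∑-cong (nE G) at-port
    where
    at-port : ∀ e → b2n (⌊ fE e ≟ k ⌋ ∧ ⌊ proj₁ (arcᴳ e) ≟ x ⌋)
                  ≡ b2n (⌊ fE e ≟ k ⌋ ∧ ⌊ lp e ≟ᴾ (x , v) ⌋)
    at-port e with fE e ≟ k
    ... | no  _    = refl
    ... | yes refl = cong b2n (⌊⌋-⇔ (proj₁ (arcᴳ e) ≟ x) (lp e ≟ᴾ (x , v))
                       (λ { refl → cong (x ,_) (fits-target (ends H (fE e)) (image-fits e) fits-xv) }) (cong proj₁))

  heads-port : ∀ {k x u} → fits (ends H k) u (fV x) ≡ true → heads x k ≡ PS.at rp fE (x , u) k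
  heads-port {k} {x} {u} fits-ux = ∑-cong (nE G) at-port
    where
    at-port : ∀ e → b2n (⌊ fE e ≟ k ⌋ ∧ ⌊ proj₂ (arcᴳ e) ≟ x ⌋)
                  ≡ b2n (⌊ fE e ≟ k ⌋ ∧ ⌊ rp e ≟ᴾ (x , u) ⌋)
    at-port e with fE e ≟ k
    ... | no  _    = refl
    ... | yes refl = cong b2n (⌊⌋-⇔ (proj₂ (arcᴳ e) ≟ x) (rp e ≟ᴾ (x , u))
                       (λ { refl → cong (x ,_) (fits-source (ends H (fE e)) (image-fits e) fits-ux) }) (cong proj₁))

  tails-none : ∀ {k x} → (∀ v → fits (ends H k) (fV x) v ≡ false) → tails x k ≡ 0
  tails-none {k} {x} none = count-false _ not-tail
    where
    not-tail : ∀ e → ⌊ fE e ≟ k ⌋ ∧ ⌊ proj₁ (arcᴳ e) ≟ x ⌋ ≡ false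
    not-tail e with fE e ≟ k | proj₁ (arcᴳ e) ≟ x
    ... | yes refl | yes refl = ⊥-elim (Boolₚ.not-¬ (none _) (image-fits e))
    ... | yes _    | no _     = refl
    ... | no _     | _        = refl

  heads-none : ∀ {k x} → (∀ u → fits (ends H k) u (fV x) ≡ false) → heads x k ≡ 0
  heads-none {k} {x} none = count-false _ not-head
    where
    not-head : ∀ e → ⌊ fE e ≟ k ⌋ ∧ ⌊ proj₂ (arcᴳ e) ≟ x ⌋ ≡ false
    not-head e with fE e ≟ k | proj₂ (arcᴳ e) ≟ x
    ... | yes refl | yes refl = ⊥-elim (Boolₚ.not-¬ (none _) (image-fits e))
    ... | yes _    | no _     = refl
    ... | no _     | _        = refl

  exact-left : ∀ p k → palette-left p k ≡ true → PS.at lp fE p k ≡ 1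
  exact-left = proj₁ (proj₂ (proj₂ colouring))

  exact-right : ∀ p k → palette-right p k ≡ true → PS.at rp fE p k ≡ 1
  exact-right = proj₂ (proj₂ (proj₂ colouring))

  loop-fibre : ∀ k w → ends H k ≡ loop w → ∀ x → fV x ≡ w → degIn G (λ e → ⌊ fE e ≟ k ⌋) x ≡ 2
  loop-fibre k w hk x refl = begin
    degIn G (λ e → ⌊ fE e ≟ k ⌋) x                        ≡⟨ preimage-degree k x ⟩
    tails x k + heads x k                                  ≡⟨ cong₂ _+_ (tails-port fits-ww) (heads-port fits-ww) ⟩
    PS.at lp fE (x , fV x) k + PS.at rp fE (x , fV x) k
      ≡⟨ cong₂ _+_ (exact-left (x , fV x) k fits-ww) (exact-right (x , fV x) k fits-ww) ⟩
    2                                                      ∎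
    where
    open ≡-Reasoning
    fits-ww : fits (ends H k) (fV x) (fV x) ≡ true
    fits-ww = fits-loop (ends H k) hk

  ord-end : ∀ k x {b} → fV x ≢ b → ends H k ≡ ord (fV x) b ⊎ ends H k ≡ ord b (fV x) →
            degIn G (λ e → ⌊ fE e ≟ k ⌋) x ≡ 1
  ord-end k x {b} a≢b joins with Finₚ.<-cmp (fV x) b
  ... | tri< a<b _ _ = begin
    degIn G (λ e → ⌊ fE e ≟ k ⌋) x   ≡⟨ preimage-degree k x ⟩
    tails x k + heads x k           ≡⟨ cong₂ _+_ (tails-port fits-ab) (heads-none entering) ⟩
    PS.at lp fE (x , b) k + 0       ≡⟨ cong (_+ 0) (exact-left (x , b) k fits-ab) ⟩
    1                               ∎
    where
    open ≡-Reasoning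
    fits-ab : fits (ends H k) (fV x) b ≡ true
    fits-ab = fits-ord (ends H k) a<b joins
    entering : ∀ u → fits (ends H k) u (fV x) ≡ false
    entering u = Boolₚ.¬-not λ fits-ua → a≢b (proj₂ (fits-chain (ends H k) fits-ua fits-ab))
  ... | tri≈ _ a≡b _ = ⊥-elim (a≢b a≡b)
  ... | tri> _ _ b<a = begin
    degIn G (λ e → ⌊ fE e ≟ k ⌋) x   ≡⟨ preimage-degree k x ⟩
    tails x k + heads x k           ≡⟨ cong₂ _+_ (tails-none leaving) (heads-port fits-ba) ⟩
    0 + PS.at rp fE (x , b) k       ≡⟨ exact-right (x , b) k fits-ba ⟩
    1                               ∎
    where
    open ≡-Reasoning
    fits-ba : fits (ends H k) b (fV x) ≡ true
    fits-ba = fits-ord (ends H k) b<a (Data.Sum.swap joins)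
    leaving : ∀ v → fits (ends H k) (fV x) v ≡ false
    leaving v = Boolₚ.¬-not λ fits-av → a≢b (sym (proj₁ (fits-chain (ends H k) fits-ba fits-av)))

  ord-fibre : ∀ k w w' → ends H k ≡ ord w w' → ∀ x → fV x ≡ w ⊎ fV x ≡ w' →
              degIn G (λ e → ⌊ fE e ≟ k ⌋) x ≡ 1
  ord-fibre k w w' hk x (inj₁ refl) = ord-end k x (ord-distinct H k (fV x) w' hk) (inj₁ hk)
  ord-fibre k w w' hk x (inj₂ refl) = ord-end k x (ord-distinct H k w (fV x) hk ∘ sym) (inj₂ hk)

  image-fits-arc : ∀ e {s t} → arcᴳ e ≡ (s , t) → fits (ends H (fE e)) (fV s) (fV t) ≡ true
  image-fits-arc e refl = image-fits e

  arc-ord : ∀ e {u v} → ends G e ≡ ord u v → arcᴳ e ≡ (u , v) ⊎ arcᴳ e ≡ (v , u)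
  arc-ord e {u} {v} eq rewrite eq = direct-cases _ (u , v)

  loop-image : ∀ e u → ends G e ≡ loop u → ends H (fE e) ≡ loop (fV u)
  loop-image e u eq = fits-refl-true (ends H (fE e)) (image-fits-arc e (cong (arc (proj₁ orientation e)) eq))

  ord-image-same : ∀ e {u v} → ends G e ≡ ord u v → fV u ≡ fV v → ends H (fE e) ≡ loop (fV u)
  ord-image-same e {u} {v} eq fu≡fv with arc-ord e eq
  ... | inj₁ arc≡ = fits-refl-true (ends H (fE e))
                      (subst (λ t → fits (ends H (fE e)) (fV u) t ≡ true) (sym fu≡fv) (image-fits-arc e arc≡))
  ... | inj₂ arc≡ = fits-refl-true (ends H (fE e))
                      (subst (λ s → fits (ends H (fE e)) s (fV u) ≡ true) (sym fu≡fv) (image-fits-arc e arc≡))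

  ord-image-distinct : ∀ e u v → ends G e ≡ ord u v → fV u ≢ fV v →
                       ends H (fE e) ≡ ord (fV u) (fV v) ⊎ ends H (fE e) ≡ ord (fV v) (fV u)
  ord-image-distinct e u v eq fu≢fv with arc-ord e eq
  ... | inj₁ arc≡ = fits-≢-true (ends H (fE e)) (image-fits-arc e arc≡) fu≢fv
  ... | inj₂ arc≡ = Data.Sum.swap (fits-≢-true (ends H (fE e)) (image-fits-arc e arc≡) (fu≢fv ∘ sym))


proposition6 : (G H : Graph) → NoSemiEdges H →
    (fV : Vertex G → Vertex H) → Surjective fV → DegreeObedient G H fV →
    Σ (Edge G → Edge H) (λ fE → IsCovering G H fV fE)
proposition6 G H noSemiH fV _ degree-obedient = fE , record
  { loop-map         = loop-image
  ; semi-map         = λ e u eq → ⊥-elim (noSemiG e u eq)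
  ; ord-map-distinct = ord-image-distinct
  ; ord-map-same     = λ e u v eq fu≡fv → inj₁ (ord-image-same e eq fu≡fv)
  ; loop-fibre       = loop-fibre
  ; semi-fibre       = λ k w eq → ⊥-elim (noSemiH k w eq)
  ; ord-fibre        = ord-fibre
  }
  where open Construction G H noSemiH fV degree-obedient
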